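{- Let $q\neq 2$ be a prime power, $\mathbb{A}=\mathbb{F}_q[x]$, and $\mathbb{M}$ the set of monic polynomials in $\mathbb{A}$. For non-constant $f\in\mathbb{A}$ let $\Phi(f)=|(\mathbb{A}/f\mathbb{A})^*|$, and for a positive integer $n$ let $\Phi^{ -1}(n)\cap\mathbb{M}$ be the set of non-constant monic $f$ with $\Phi(f)=n$. Then for every integer $l\ge0$ there exists a positive integer $n$ such that $|\Phi^{ -1}(n)\cap\mathbb{M}|=\binom{q}{2}(l+1)$. -}

module Defs where

open import Level using (0ℓ)
open import Data.Nat using (ℕ; zero; suc)
open import Data.Fin using (Fin)
open import Data.List using (List; []; _∷_; map; _++_; [_]; length)
open import Data.List.Relation.Unary.All using (All)
open import Data.List.Relation.Unary.Unique.Propositional using (Unique)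
open import Data.List.Membership.Propositional using (_∈_)
open import Data.Vec using (Vec; toList)
open import Data.Product using (Σ; ∃; _×_; _,_)
open import Relation.Binary.PropositionalEquality using (_≡_; _≢_)
open import Relation.Nullary using (¬_)
open import Function.Bundles using (_↔_; _⇔_)
open import Algebra.Structures using (IsCommutativeRing)

record FiniteField : Set₁ where
  field
    Carrier : Set
    _+_ _*_ : Carrier → Carrier → Carrier
    -_      : Carrier → Carrier
    0# 1#   : Carrier
    isCommutativeRing : IsCommutativeRing _≡_ _+_ _*_ -_ 0# 1#
    0≢1     : 0# ≢ 1#
    inverse : ∀ x → x ≢ 0# → Σ Carrier (λ y → x * y ≡ 1#)
    size    : ℕ
    enum    : Carrier ↔ Fin size

HasCard : {A : Set} → (A → Set) → ℕ → Set
HasCard {A} P n = Σ (List A) λ xs → Unique xs × (∀ x → (x ∈ xs) ⇔ P x) × length xs ≡ n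

module Poly (F : FiniteField) where
  open FiniteField F

  -- Polynomials in F[x] as coefficient lists, lowest degree first
  -- (trailing zeros allowed; equality is ≈ₚ below).
  Pol : Set
  Pol = List Carrier

  _+ₚ_ : Pol → Pol → Pol
  [] +ₚ q = q
  (a ∷ p) +ₚ [] = a ∷ p
  (a ∷ p) +ₚ (b ∷ q) = (a + b) ∷ (p +ₚ q)

  negₚ : Pol → Pol
  negₚ = map -_

  _*ₚ_ : Pol → Pol → Pol
  [] *ₚ q = []
  (a ∷ p) *ₚ q = map (a *_) q +ₚ (0# ∷ (p *ₚ q))

  1ₚ : Pol
  1ₚ = 1# ∷ []

  _≈ₚ_ : Pol → Pol → Set
  p ≈ₚ q = All (_≡ 0#) (p +ₚ negₚ q)

  monic : (d : ℕ) → Vec Carrier d → Pol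
  monic d v = toList v ++ [ 1# ]

  -- Non-constant monic polynomials: degree suc d, lower coefficients.
  MonicNC : Set
  MonicNC = Σ ℕ λ d → Vec Carrier (suc d)

  IsUnitMod : Pol → Pol → Set
  IsUnitMod f g = Σ Pol λ h → Σ Pol λ k → (g *ₚ h) ≈ₚ (1ₚ +ₚ (k *ₚ f))

  -- Φ(f) = n, where Φ(f) = |(A/fA)^*|; residues mod f (deg f = D) are
  -- represented uniquely by polynomials of degree < D, i.e. by Vec Carrier D.
  PhiIs : MonicNC → ℕ → Set
  PhiIs (d , v) n = HasCard {Vec Carrier (suc d)} (λ g → IsUnitMod (monic (suc d) v) (toList g)) n

{-# OPTIONS --safe #-}
-- Write Φ(f) = q ^ s * m with m coprime to q. If f = ∏ Pᵢ ^ (eᵢ + 1) with distinct monic primes Pᵢ,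
-- the Chinese remainder theorem and the count of units modulo a prime power give
-- Φ(f) = ∏ q ^ (eᵢ deg Pᵢ) * (q ^ deg Pᵢ - 1), so m = ∏ (q ^ deg Pᵢ - 1). As q - 1 ≥ 2 (this is where
-- q ≠ 2 enters), m = (q - 1)² exactly when f has two distinct prime factors, both linear. So the monic f
-- with Φ(f) = q ^ l * (q - 1)² are the (x - a) ^ (i + 1) * (x - b) ^ (j + 1) with a ≠ b and i + j = l,
-- indexed by an unordered pair {a, b} and i ∈ [0, l].
module Submission where

open import Level using (0ℓ)
open import Defs
open import Data.Nat as ℕ using (ℕ; zero; suc; z≤n; s≤s; _≤_; _<_; _^_; _∸_; NonZero)
import Data.Nat.Properties as ℕ
open import Data.Nat.Combinatorics using (_C_)
open import Data.Nat.Coprimality using (Coprime)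
open import Data.Nat.Induction using (<-wellFounded)
open import Induction.WellFounded using (Acc; acc)
open import Data.Fin as Fin using (Fin; toℕ; fromℕ<)
import Data.Fin.Properties as Fin
open import Data.List using (List; []; _∷_)
open import Data.List.Relation.Unary.All using (All; []; _∷_)
open import Data.Vec as Vec using (Vec; []; _∷_; toList; replicate)
import Data.Vec.Properties as Vec
open import Data.Product using (Σ; ∃; _×_; _,_; proj₁; proj₂)
open import Data.Sum as Sum using (_⊎_; inj₁; inj₂)
open import Data.Unit using (⊤; tt)
open import Data.Empty using (⊥-elim)
open import Relation.Binary.PropositionalEquality hiding ([_])
open import Relation.Binary.Definitions using (tri<; tri≈; tri>)
open import Relation.Nullary using (Dec; yes; no; ¬_; contradiction)
open import Relation.Nullary.Decidable using (map′)
open import Function using (_∘_; Inverse)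
open import Function.Bundles using (_⇔_; mk⇔; Equivalence)
open import Algebra.Bundles using (CommutativeRing)
import Algebra.Properties.Ring as RingProperties

module Counting where
  open import Data.Nat using (_+_; _*_)
  open import Data.Nat.Combinatorics using (nC1≡n; nCk+nC[k+1]≡[n+1]C[k+1])
  open import Data.Fin using (zero; suc)
  open import Data.List using (map; _++_; length; filter; cartesianProduct; allFin)
  import Data.List.Properties as List
  open import Data.List.Relation.Unary.Any as Any using (here; there)
  import Data.List.Relation.Unary.All as All
  import Data.List.Relation.Unary.All.Properties as All
  open import Data.List.Relation.Unary.AllPairs using ([]; _∷_)
  open import Data.List.Relation.Unary.Unique.Propositional using (Unique)
  import Data.List.Relation.Unary.Unique.Propositional.Properties as Unique
  open import Data.List.Membership.Propositional using (_∈_; lose)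
  open import Data.List.Membership.Propositional.Properties
  open import Data.Product using (uncurry) renaming (map to ×-map)
  open import Relation.Nullary using (¬?)
  open import Relation.Unary using (Pred; Decidable)
  open import Function using (_∘′_; id; Injection; _↔_)
  open import Function.Properties.Inverse using (↔-sym; Inverse⇒Injection)
  open import Function.Properties.Equivalence using () renaming (trans to ⇔-trans)
  open Equivalence using (to; from)

  private
    variable
      A B : Set
      P Q : Pred A _
      m n : ℕ

  private
    remove : {x : A} (ys : List A) → x ∈ ys → List A
    remove (y ∷ ys) (here _) = ys
    remove (y ∷ ys) (there p) = y ∷ remove ys p

    length-remove : {x : A} (ys : List A) (x∈ys : x ∈ ys) → length ys ≡ suc (length (remove ys x∈ys))
    length-remove (y ∷ ys) (here _) = refl
    length-remove (y ∷ ys) (there p) = cong suc (length-remove ys p)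

    ∈-remove : {x y : A} (ys : List A) (x∈ys : x ∈ ys) → y ∈ ys → y ≢ x → y ∈ remove ys x∈ys
    ∈-remove (z ∷ ys) (here refl) (here refl) y≢x = ⊥-elim (y≢x refl)
    ∈-remove (z ∷ ys) (here refl) (there y∈ys) y≢x = y∈ys
    ∈-remove (z ∷ ys) (there x∈ys) (here refl) y≢x = here refl
    ∈-remove (z ∷ ys) (there x∈ys) (there y∈ys) y≢x = there (∈-remove ys x∈ys y∈ys y≢x)

  length-mono-⊆ : {xs ys : List A} → Unique xs → (∀ {x} → x ∈ xs → x ∈ ys) → length xs ≤ length ys
  length-mono-⊆ {xs = []} _ _ = z≤n
  length-mono-⊆ {xs = x ∷ xs} {ys} (x∉xs ∷ uxs) xs⊆ys =
    subst (suc (length xs) ≤_) (sym (length-remove ys x∈ys))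
      (s≤s (length-mono-⊆ uxs λ y∈xs → ∈-remove ys x∈ys (xs⊆ys (there y∈xs)) λ { refl → All.lookup x∉xs y∈xs refl }))
    where x∈ys = xs⊆ys (here refl)

  HasCard-unique : HasCard P m → HasCard P n → m ≡ n
  HasCard-unique (xs , uxs , ∈xs , refl) (ys , uys , ∈ys , refl) =
    ℕ.≤-antisym (length-mono-⊆ uxs λ {x} → from (∈ys x) ∘′ to (∈xs x))
                (length-mono-⊆ uys λ {x} → from (∈xs x) ∘′ to (∈ys x))

  HasCard-⇔ : (∀ x → P x ⇔ Q x) → HasCard P n → HasCard Q n
  HasCard-⇔ P⇔Q (xs , uxs , ∈xs , len) = xs , uxs , (λ x → ⇔-trans (∈xs x) (P⇔Q x)) , len

  private
    map⁺-injectiveOn : (f : A → B) → (∀ {x y} → P x → P y → f x ≡ f y → x ≡ y) →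
                       {xs : List A} → All.All P xs → Unique xs → Unique (map f xs)
    map⁺-injectiveOn f inj All.[] [] = []
    map⁺-injectiveOn f inj (px All.∷ pxs) (x∉xs ∷ uxs) =
      All.map⁺ (All.zipWith (λ (py , x≢y) fx≡fy → x≢y (inj px py fx≡fy)) (pxs , x∉xs)) ∷ map⁺-injectiveOn f inj pxs uxs

  HasCard-image : (f : A → B) → (∀ {x y} → P x → P y → f x ≡ f y → x ≡ y) →
                  (∀ y → Q y ⇔ Σ A λ x → P x × f x ≡ y) → HasCard P n → HasCard Q n
  HasCard-image {P = P} f inj Q⇔image (xs , uxs , ∈xs , len) =
    map f xs ,
    map⁺-injectiveOn f inj (All.tabulate (to (∈xs _))) uxs ,
    (λ y → mk⇔ (λ y∈ → let x , x∈ , y≡fx = ∈-map⁻ f y∈ in from (Q⇔image y) (x , to (∈xs x) x∈ , sym y≡fx))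
               (λ qy → let x , px , fx≡y = to (Q⇔image y) qy in subst (_∈ map f xs) fx≡y (∈-map⁺ f (from (∈xs x) px)))) ,
    trans (List.length-map f xs) len

  HasCard-× : HasCard P m → HasCard Q n → HasCard (λ (x , y) → P x × Q y) (m * n)
  HasCard-× (xs , uxs , ∈xs , refl) (ys , uys , ∈ys , refl) =
    cartesianProduct xs ys ,
    Unique.cartesianProduct⁺ uxs uys ,
    (λ (x , y) → mk⇔ (λ xy∈ → let x∈ , y∈ = ∈-cartesianProduct⁻ xs ys xy∈ in to (∈xs x) x∈ , to (∈ys y) y∈)
                     (λ (px , qy) → ∈-cartesianProduct⁺ (from (∈xs x) px) (from (∈ys y) qy))) ,
    length-cartesianProduct xs ys
    where
      length-cartesianProduct : (xs : List A) (ys : List B) → length (cartesianProduct xs ys) ≡ length xs * length ys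
      length-cartesianProduct [] ys = refl
      length-cartesianProduct (x ∷ xs) ys = begin
        length (map (x ,_) ys ++ cartesianProduct xs ys)
          ≡⟨ List.length-++ (map (x ,_) ys) ⟩
        length (map (x ,_) ys) + length (cartesianProduct xs ys)
          ≡⟨ cong₂ _+_ (List.length-map (x ,_) ys) (length-cartesianProduct xs ys) ⟩
        length ys + length xs * length ys ∎
        where open ≡-Reasoning

  private
    length-filter-∁ : (P? : Decidable P) (xs : List A) →
                      length (filter P? xs) + length (filter (¬? ∘ P?) xs) ≡ length xs
    length-filter-∁ P? [] = refl
    length-filter-∁ P? (x ∷ xs) with P? x
    ... | yes _ = cong suc (length-filter-∁ P? xs)
    ... | no _ = trans (ℕ.+-suc _ _) (cong suc (length-filter-∁ P? xs))

    HasCard-filter : (P? : Decidable P) {xs : List A} → Unique xs → (∀ x → x ∈ xs) → HasCard P (length (filter P? xs))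
    HasCard-filter P? {xs} uxs all∈ =
      _ , Unique.filter⁺ P? uxs , (λ x → mk⇔ (proj₂ ∘ ∈-filter⁻ P? {xs = xs}) (∈-filter⁺ P? (all∈ x))) , refl

  HasCard-∁ : {P : A → Set} → Decidable P → HasCard {A} (λ _ → ⊤) m → HasCard P n → HasCard (¬_ ∘ P) (m ∸ n)
  HasCard-∁ {n = n} {P = P} P? (xs , uxs , ∈xs , refl) card-P =
    subst (HasCard (¬_ ∘ P)) length≡ (HasCard-filter (¬? ∘ P?) uxs all∈)
    where
      all∈ = λ x → from (∈xs x) tt
      length≡ : length (filter (¬? ∘ P?) xs) ≡ length xs ∸ n
      length≡ = begin
        length (filter (¬? ∘ P?) xs)
          ≡⟨ ℕ.m+n∸m≡n (length (filter P? xs)) _ ⟨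
        length (filter P? xs) + length (filter (¬? ∘ P?) xs) ∸ length (filter P? xs)
          ≡⟨ cong₂ _∸_ (length-filter-∁ P? xs) (HasCard-unique (HasCard-filter P? uxs all∈) card-P) ⟩
        length xs ∸ n ∎
        where open ≡-Reasoning

  HasCard-Fin : HasCard {Fin n} (λ _ → ⊤) n
  HasCard-Fin {n} = allFin n , Unique.allFin⁺ n , (λ i → mk⇔ (λ _ → tt) (λ _ → ∈-allFin i)) , List.length-tabulate id

  HasCard-↔ : {q : ℕ} → A ↔ Fin q → HasCard {A} (λ _ → ⊤) q
  HasCard-↔ A↔Fin = HasCard-image I.from (λ _ _ → Injection.injective (Inverse⇒Injection (↔-sym A↔Fin)))
    (λ x → mk⇔ (λ _ → I.to x , tt , I.strictlyInverseʳ x) (λ _ → tt)) HasCard-Fin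
    where module I = Inverse A↔Fin

  HasCard-Vec : {q : ℕ} → A ↔ Fin q → ∀ n → HasCard {Vec A n} (λ _ → ⊤) (q ^ n)
  HasCard-Vec A↔Fin zero = [] ∷ [] , All.[] ∷ [] , (λ { [] → mk⇔ (λ _ → tt) (λ _ → here refl) }) , refl
  HasCard-Vec A↔Fin (suc n) = HasCard-image (uncurry _∷_) (λ { _ _ refl → refl })
    (λ { (x ∷ v) → mk⇔ (λ _ → (x , v) , (tt , tt) , refl) (λ _ → tt) })
    (HasCard-× (HasCard-↔ A↔Fin) (HasCard-Vec A↔Fin n))

  private
    pairs : ∀ n → List (Fin n × Fin n)
    pairs zero = []
    pairs (suc n) = map (λ y → zero , suc y) (allFin n) ++ map (×-map suc suc) (pairs n)

    unique-pairs : ∀ n → Unique (pairs n)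
    unique-pairs zero = []
    unique-pairs (suc n) =
      Unique.++⁺ (Unique.map⁺ (λ { refl → refl }) (Unique.allFin⁺ n)) (Unique.map⁺ (λ { refl → refl }) (unique-pairs n)) disjoint
      where
        disjoint : ∀ {xy} → ¬ (xy ∈ map (λ y → zero , suc y) (allFin n) × xy ∈ map (×-map suc suc) (pairs n))
        disjoint (xy∈ˡ , xy∈ʳ) with ∈-map⁻ _ xy∈ˡ | ∈-map⁻ _ xy∈ʳ
        ... | _ , _ , refl | _ , _ , ()

    ∈-pairs⇒< : ∀ {n} (x y : Fin n) → (x , y) ∈ pairs n → x Fin.< y
    ∈-pairs⇒< {suc n} x y xy∈ with ∈-++⁻ (map (λ y → zero , suc y) (allFin n)) xy∈
    ... | inj₁ xy∈ˡ with ∈-map⁻ _ xy∈ˡ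
    ...   | _ , _ , refl = s≤s z≤n
    ∈-pairs⇒< {suc n} x y xy∈ | inj₂ xy∈ʳ with ∈-map⁻ _ xy∈ʳ
    ...   | (x′ , y′) , xy∈′ , refl = s≤s (∈-pairs⇒< x′ y′ xy∈′)

    <⇒∈-pairs : ∀ {n} (x y : Fin n) → x Fin.< y → (x , y) ∈ pairs n
    <⇒∈-pairs {suc n} zero (suc y) _ = ∈-++⁺ˡ (∈-map⁺ (λ y → zero , suc y) (∈-allFin y))
    <⇒∈-pairs {suc n} (suc x) (suc y) (s≤s x<y) =
      ∈-++⁺ʳ (map (λ y → zero , suc y) (allFin n)) (∈-map⁺ (×-map suc suc) (<⇒∈-pairs x y x<y))

    length-pairs : ∀ n → length (pairs n) ≡ n C 2
    length-pairs zero = refl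
    length-pairs (suc n) = begin
      length (map (λ y → zero , suc y) (allFin n) ++ map (×-map suc suc) (pairs n))
        ≡⟨ List.length-++ (map (λ y → zero , suc y) (allFin n)) ⟩
      length (map (λ y → zero , suc y) (allFin n)) + length (map (×-map suc suc) (pairs n))
        ≡⟨ cong₂ _+_ (trans (List.length-map _ (allFin n)) (List.length-tabulate id)) (trans (List.length-map _ (pairs n)) (length-pairs n)) ⟩
      n + n C 2
        ≡⟨ cong (_+ n C 2) (nC1≡n n) ⟨
      n C 1 + n C 2
        ≡⟨ nCk+nC[k+1]≡[n+1]C[k+1] n 1 ⟩
      suc n C 2 ∎
      where open ≡-Reasoning

  HasCard-<-pairs : ∀ n → HasCard {Fin n × Fin n} (λ (x , y) → x Fin.< y) (n C 2)
  HasCard-<-pairs n = pairs n , unique-pairs n , (λ (x , y) → mk⇔ (∈-pairs⇒< x y) (<⇒∈-pairs x y)) , length-pairs n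

  HasCard-∃? : HasCard {A} (λ _ → ⊤) n → Decidable P → Dec (Σ A P)
  HasCard-∃? (xs , _ , ∈xs , _) P? = map′ Any.satisfied (λ (x , px) → lose (from (∈xs x) tt) px) (Any.any? P? xs)

open Counting

module Arithmetic where
  open import Data.Nat
  open import Data.Nat.Properties
  open import Data.Nat.Divisibility using (_∣_; ∣-refl; ∣-trans; m∣m*n; ∣1⇒≡1; ∣m+n∣m⇒∣n)
  open import Data.Nat.Coprimality using (coprime-divisor)
  open import Data.Nat.Solver using (module +-*-Solver)

  coprime-* : ∀ {a b n} → Coprime a n → Coprime b n → Coprime (a * b) n
  coprime-* a⊥n b⊥n (d∣ab , d∣n) = b⊥n (coprime-divisor (λ (e∣d , e∣a) → a⊥n (e∣a , ∣-trans e∣d d∣n)) d∣ab , d∣n)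

  coprime-^∸1 : ∀ {q} .{{_ : NonZero q}} e → Coprime (q ^ suc e ∸ 1) q
  coprime-^∸1 {q} e {d} (d∣q^∸1 , d∣q) = ∣1⇒≡1 (∣m+n∣m⇒∣n d∣q^ d∣q^∸1)
    where
      d∣q^ : d ∣ q ^ suc e ∸ 1 + 1
      d∣q^ = subst (d ∣_) (sym (m∸n+n≡m (m^n>0 q (suc e)))) (∣-trans d∣q (m∣m*n (q ^ e)))

  coprime⇒∤ : ∀ {m n} → 2 ≤ n → Coprime m n → ¬ n ∣ m
  coprime⇒∤ 2≤n m⊥n n∣m = <⇒≢ 2≤n (sym (m⊥n (n∣m , ∣-refl)))

  ^*-cancelˡ : ∀ q .{{_ : NonZero q}} s t {m k} → q ^ s * m ≡ q ^ (s + t) * k → m ≡ q ^ t * k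
  ^*-cancelˡ q s t {m} {k} eq = *-cancelˡ-≡ m (q ^ t * k) (q ^ s) {{m^n≢0 q s}} (begin
    q ^ s * m           ≡⟨ eq ⟩
    q ^ (s + t) * k     ≡⟨ cong (_* k) (^-distribˡ-+-* q s t) ⟩
    q ^ s * q ^ t * k   ≡⟨ *-assoc (q ^ s) (q ^ t) k ⟩
    q ^ s * (q ^ t * k) ∎)
    where open ≡-Reasoning

  m<n⇒n≡m+1+[n∸1+m] : ∀ {m n} → m < n → n ≡ m + suc (n ∸ suc m)
  m<n⇒n≡m+1+[n∸1+m] {m} {n} m<n = sym (trans (+-suc m (n ∸ suc m)) (m+[n∸m]≡n m<n))

  private
    ^*-coprime-< : ∀ {q s l m k} → 2 ≤ q → Coprime m q → s < l → q ^ s * m ≢ q ^ l * k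
    ^*-coprime-< {q} {s} {l} {m} {k} 2≤q m⊥q s<l eq =
      coprime⇒∤ 2≤q m⊥q (subst (q ∣_) (sym m≡) (∣-trans (m∣m*n (q ^ t)) (m∣m*n k)))
      where
        instance _ = >-nonZero (<-trans z<s 2≤q)
        t = l ∸ suc s
        m≡ : m ≡ q * q ^ t * k
        m≡ = ^*-cancelˡ q s (suc t) (trans eq (cong (λ l → q ^ l * k) (m<n⇒n≡m+1+[n∸1+m] s<l)))

  ^*-coprime-injective : ∀ {q m k} s l → 2 ≤ q → Coprime m q → Coprime k q → q ^ s * m ≡ q ^ l * k → s ≡ l × m ≡ k
  ^*-coprime-injective {q} {m} {k} s l 2≤q m⊥q k⊥q eq with <-cmp s l
  ... | tri≈ _ refl _ = refl , *-cancelˡ-≡ m k (q ^ s) {{m^n≢0 q s {{>-nonZero (<-trans z<s 2≤q)}}}} eq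
  ... | tri< s<l _ _ = contradiction eq (^*-coprime-< 2≤q m⊥q s<l)
  ... | tri> _ _ l<s = contradiction (sym eq) (^*-coprime-< 2≤q k⊥q l<s)

  ^∸^≡^*[^∸1] : ∀ q a b → q ^ (a + b) ∸ q ^ b ≡ q ^ b * (q ^ a ∸ 1)
  ^∸^≡^*[^∸1] q a b = begin
    q ^ (a + b) ∸ q ^ b          ≡⟨ cong₂ _∸_ (^-distribˡ-+-* q a b) (sym (*-identityˡ (q ^ b))) ⟩
    q ^ a * q ^ b ∸ 1 * q ^ b    ≡⟨ *-distribʳ-∸ (q ^ b) (q ^ a) 1 ⟨
    (q ^ a ∸ 1) * q ^ b          ≡⟨ *-comm _ (q ^ b) ⟩
    q ^ b * (q ^ a ∸ 1)          ∎
    where open ≡-Reasoning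

  ^*-*-^* : ∀ q a x b y → (q ^ a * x) * (q ^ b * y) ≡ q ^ (a + b) * (x * y)
  ^*-*-^* q a x b y = begin
    (q ^ a * x) * (q ^ b * y)
      ≡⟨ solve 4 (λ A x B y → (A :* x) :* (B :* y) := (A :* B) :* (x :* y)) refl (q ^ a) x (q ^ b) y ⟩
    (q ^ a * q ^ b) * (x * y)
      ≡⟨ cong (_* (x * y)) (^-distribˡ-+-* q a b) ⟨
    q ^ (a + b) * (x * y) ∎
    where
      open ≡-Reasoning
      open +-*-Solver

  [1+p]^1∸1≡p : ∀ p → suc p ^ 1 ∸ 1 ≡ p
  [1+p]^1∸1≡p p = cong (_∸ 1) (*-identityʳ (suc p))

  p≤[1+p]^d∸1 : ∀ p d → 1 ≤ d → p ≤ suc p ^ d ∸ 1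
  p≤[1+p]^d∸1 p d 1≤d = subst (_≤ suc p ^ d ∸ 1) ([1+p]^1∸1≡p p) (∸-monoˡ-≤ 1 (^-monoʳ-≤ (suc p) 1≤d))

  p*p<[1+p]^d∸1 : ∀ {p} d → 1 ≤ p → 2 ≤ d → p * p < suc p ^ d ∸ 1
  p*p<[1+p]^d∸1 {p} d 1≤p 2≤d = <-≤-trans p*p<[1+p]²∸1 (∸-monoˡ-≤ 1 (^-monoʳ-≤ (suc p) 2≤d))
    where
      p*p<[1+p]²∸1 : p * p < suc p ^ 2 ∸ 1
      p*p<[1+p]²∸1 = subst (p * p <_) (sym (cong (_∸ 1) [1+p]²≡1+p*p+2p)) (m<m+n (p * p) (≤-trans 1≤p (m≤m+n p p)))
        where
          open +-*-Solver
          [1+p]²≡1+p*p+2p : suc p ^ 2 ≡ 1 + (p * p + (p + p))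
          [1+p]²≡1+p*p+2p = solve 1 (λ p → (con 1 :+ p) :* ((con 1 :+ p) :* con 1) := con 1 :+ (p :* p :+ (p :+ p))) refl p

open Arithmetic

-- With coefficients taken from the ring itself, as in Tactic.RingSolver, constants such as 1 · 1 would
-- not normalise to 1 for an abstract ring; integer coefficients compute.
module IntegerCoefficientSolver {c ℓ} (R : CommutativeRing c ℓ) where
  open import Data.Integer as ℤ using (ℤ; +_; -[1+_]; _⊖_)
  import Data.Integer.Properties as ℤ
  open import Data.Sign as Sign using (Sign)
  open import Data.Maybe using (Maybe; just; nothing)
  import Relation.Binary.PropositionalEquality as ≡
  open import Algebra.Bundles using (RawRing)
  open import Algebra.Solver.Ring.AlmostCommutativeRing using (fromCommutativeRing; _-Raw-AlmostCommutative⟶_)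
  open CommutativeRing R hiding (zero; setoid) renaming (refl to ≈-refl; sym to ≈-sym; trans to ≈-trans)
  open import Algebra.Properties.Semiring.Mult.TCOptimised semiring using (×-homo-+; ×1-homo-*; 1+×) renaming (_×_ to _times_)
  open import Algebra.Properties.Ring ring using (-‿distribˡ-*; -‿distribʳ-*; -‿involutive; -0#≈0#; -‿+-comm)
  open import Relation.Binary.Reasoning.Setoid (CommutativeRing.setoid R)

  private
    ⟦_⟧ : ℤ → Carrier
    ⟦ + n ⟧ = n times 1#
    ⟦ -[1+ n ] ⟧ = - (suc n times 1#)

    signed : Sign → Carrier → Carrier
    signed Sign.+ x = x
    signed Sign.- x = - x

    ⟦◃⟧ : ∀ s n → ⟦ s ℤ.◃ n ⟧ ≈ signed s (n times 1#)
    ⟦◃⟧ Sign.+ zero = ≈-refl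
    ⟦◃⟧ Sign.- zero = ≈-sym -0#≈0#
    ⟦◃⟧ Sign.+ (suc n) = ≈-refl
    ⟦◃⟧ Sign.- (suc n) = ≈-refl

    ⟦⟧≈signed : ∀ i → ⟦ i ⟧ ≈ signed (ℤ.sign i) (ℤ.∣ i ∣ times 1#)
    ⟦⟧≈signed (+ n) = ≈-refl
    ⟦⟧≈signed -[1+ n ] = ≈-refl

    signed-cong : ∀ s {x y} → x ≈ y → signed s x ≈ signed s y
    signed-cong Sign.+ x≈y = x≈y
    signed-cong Sign.- x≈y = -‿cong x≈y

    signed-* : ∀ s t x y → signed s x * signed t y ≈ signed (s Sign.* t) (x * y)
    signed-* Sign.+ Sign.+ x y = ≈-refl
    signed-* Sign.+ Sign.- x y = ≈-sym (-‿distribʳ-* x y)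
    signed-* Sign.- Sign.+ x y = ≈-sym (-‿distribˡ-* x y)
    signed-* Sign.- Sign.- x y = begin
      - x * - y     ≈⟨ -‿distribˡ-* x (- y) ⟨
      - (x * - y)   ≈⟨ -‿cong (-‿distribʳ-* x y) ⟨
      - - (x * y)   ≈⟨ -‿involutive _ ⟩
      x * y         ∎

    *-homo : ∀ i j → ⟦ i ℤ.* j ⟧ ≈ ⟦ i ⟧ * ⟦ j ⟧
    *-homo i j = begin
      ⟦ s ℤ.◃ (∣i∣ ℕ.* ∣j∣) ⟧                                         ≈⟨ ⟦◃⟧ s (∣i∣ ℕ.* ∣j∣) ⟩
      signed s ((∣i∣ ℕ.* ∣j∣) times 1#)                               ≈⟨ signed-cong s (×1-homo-* ∣i∣ ∣j∣) ⟩
      signed s ((∣i∣ times 1#) * (∣j∣ times 1#))                      ≈⟨ signed-* (ℤ.sign i) (ℤ.sign j) _ _ ⟨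
      signed (ℤ.sign i) (∣i∣ times 1#) * signed (ℤ.sign j) (∣j∣ times 1#) ≈⟨ *-cong (⟦⟧≈signed i) (⟦⟧≈signed j) ⟨
      ⟦ i ⟧ * ⟦ j ⟧                                                   ∎
      where
        s = ℤ.sign i Sign.* ℤ.sign j
        ∣i∣ = ℤ.∣ i ∣
        ∣j∣ = ℤ.∣ j ∣

    1+a-[1+b]≈a-b : ∀ a b → (1# + a) + - (1# + b) ≈ a + - b
    1+a-[1+b]≈a-b a b = begin
      (1# + a) + - (1# + b)     ≈⟨ +-congˡ (-‿+-comm 1# b) ⟨
      (1# + a) + (- 1# + - b)   ≈⟨ +-congʳ (+-comm 1# a) ⟩
      (a + 1#) + (- 1# + - b)   ≈⟨ +-assoc a 1# _ ⟩
      a + (1# + (- 1# + - b))   ≈⟨ +-congˡ (+-assoc 1# (- 1#) (- b)) ⟨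
      a + ((1# + - 1#) + - b)   ≈⟨ +-congˡ (+-congʳ (-‿inverseʳ 1#)) ⟩
      a + (0# + - b)            ≈⟨ +-congˡ (+-identityˡ (- b)) ⟩
      a + - b                   ∎

    ⟦⊖⟧ : ∀ m n → ⟦ m ⊖ n ⟧ ≈ m times 1# + - (n times 1#)
    ⟦⊖⟧ m zero = begin
      ⟦ m ⊖ zero ⟧        ≡⟨ ≡.cong ⟦_⟧ (ℤ.⊖-≥ {m} {zero} ℕ.z≤n) ⟩
      m times 1#          ≈⟨ +-identityʳ _ ⟨
      m times 1# + 0#     ≈⟨ +-congˡ -0#≈0# ⟨
      m times 1# + - 0#   ∎
    ⟦⊖⟧ zero (suc n) = ≈-sym (+-identityˡ _)
    ⟦⊖⟧ (suc m) (suc n) = begin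
      ⟦ suc m ⊖ suc n ⟧                         ≡⟨ ≡.cong ⟦_⟧ (ℤ.[1+m]⊖[1+n]≡m⊖n m n) ⟩
      ⟦ m ⊖ n ⟧                                 ≈⟨ ⟦⊖⟧ m n ⟩
      m times 1# + - (n times 1#)               ≈⟨ 1+a-[1+b]≈a-b (m times 1#) (n times 1#) ⟨
      (1# + m times 1#) + - (1# + n times 1#)   ≈⟨ +-cong (1+× m 1#) (-‿cong (1+× n 1#)) ⟨
      suc m times 1# + - (suc n times 1#)       ∎

    +-homo : ∀ i j → ⟦ i ℤ.+ j ⟧ ≈ ⟦ i ⟧ + ⟦ j ⟧
    +-homo (+ m) (+ n) = ×-homo-+ 1# m n
    +-homo (+ m) -[1+ n ] = ⟦⊖⟧ m (suc n)
    +-homo -[1+ m ] (+ n) = ≈-trans (⟦⊖⟧ n (suc m)) (+-comm _ _)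
    +-homo -[1+ m ] -[1+ n ] = begin
      - (suc (suc (m ℕ.+ n)) times 1#)          ≡⟨ ≡.cong (λ k → - (k times 1#)) (ℕ.+-suc (suc m) n) ⟨
      - ((suc m ℕ.+ suc n) times 1#)            ≈⟨ -‿cong (×-homo-+ 1# (suc m) (suc n)) ⟩
      - (suc m times 1# + suc n times 1#)       ≈⟨ -‿+-comm _ _ ⟨
      - (suc m times 1#) + - (suc n times 1#)   ∎

    -‿homo : ∀ i → ⟦ ℤ.- i ⟧ ≈ - ⟦ i ⟧
    -‿homo (+ zero) = ≈-sym -0#≈0#
    -‿homo (+ suc n) = ≈-refl
    -‿homo -[1+ n ] = ≈-sym (-‿involutive _)

    morphism : CommutativeRing.rawRing ℤ.+-*-commutativeRing -Raw-AlmostCommutative⟶ fromCommutativeRing R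
    morphism = record
      { ⟦_⟧ = ⟦_⟧ ; +-homo = +-homo ; *-homo = *-homo ; -‿homo = -‿homo ; 0-homo = ≈-refl ; 1-homo = ≈-refl }

    ⟦⟧-≟ : ∀ i j → Maybe (⟦ i ⟧ ≈ ⟦ j ⟧)
    ⟦⟧-≟ i j with i ℤ.≟ j
    ... | yes ≡.refl = just ≈-refl
    ... | no _ = nothing

  open import Algebra.Solver.Ring (CommutativeRing.rawRing ℤ.+-*-commutativeRing) (fromCommutativeRing R) morphism ⟦⟧-≟ public

module PolynomialRing (F : FiniteField) where
  open import Data.List using (map)
  open import Data.Fin.Properties using () renaming (_≟_ to _≟ᶠ_)
  open import Relation.Binary.Definitions using (DecidableEquality)
  open import Relation.Nullary.Decidable using (via-injection)
  open import Function.Properties.Inverse using (Inverse⇒Injection)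
  import Algebra.Properties.CommutativeSemigroup as CommutativeSemigroupProperties
  import Relation.Binary.Reasoning.Setoid as SetoidReasoning
  open FiniteField F using (Carrier; isCommutativeRing; 0≢1; inverse; enum)
  open Poly F

  coefficientRing : CommutativeRing 0ℓ 0ℓ
  coefficientRing = record { isCommutativeRing = isCommutativeRing }

  open CommutativeRing coefficientRing public
    using (_+_; _*_; -_; 0#; 1#; +-assoc; +-comm; +-identityˡ; +-identityʳ; -‿inverseˡ; -‿inverseʳ;
           *-assoc; *-comm; *-identityˡ; *-identityʳ; zeroˡ; zeroʳ; distribˡ; distribʳ)
  open RingProperties (CommutativeRing.ring coefficientRing) public using (-0#≈0#)
  open CommutativeSemigroupProperties (CommutativeRing.+-commutativeSemigroup coefficientRing)
    using () renaming (interchange to +-interchange; x∙yz≈y∙xz to x+[y+z]≡y+[x+z])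

  _≟_ : DecidableEquality Carrier
  _≟_ = via-injection (Inverse⇒Injection enum) _≟ᶠ_

  1≢0 : 1# ≢ 0#
  1≢0 = 0≢1 ∘ sym

  inv : ∀ a → a ≢ 0# → Carrier
  inv a a≢0 = proj₁ (inverse a a≢0)

  *-inverseʳ : ∀ a (a≢0 : a ≢ 0#) → a * inv a a≢0 ≡ 1#
  *-inverseʳ a a≢0 = proj₂ (inverse a a≢0)

  *-cancelˡ : ∀ {a} x y → a ≢ 0# → a * x ≡ a * y → x ≡ y
  *-cancelˡ {a} x y a≢0 ax≡ay = begin
    x                     ≡⟨ sym (*-identityˡ x) ⟩
    1# * x                ≡⟨ cong (_* x) (trans (sym (*-inverseʳ a a≢0)) (*-comm a _)) ⟩
    (inv a a≢0 * a) * x   ≡⟨ *-assoc _ a x ⟩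
    inv a a≢0 * (a * x)   ≡⟨ cong (inv a a≢0 *_) ax≡ay ⟩
    inv a a≢0 * (a * y)   ≡⟨ sym (*-assoc _ a y) ⟩
    (inv a a≢0 * a) * y   ≡⟨ cong (_* y) (trans (*-comm _ a) (*-inverseʳ a a≢0)) ⟩
    1# * y                ≡⟨ *-identityˡ y ⟩
    y                     ∎
    where open ≡-Reasoning

  coeff : Pol → ℕ → Carrier
  coeff [] i = 0#
  coeff (a ∷ p) zero = a
  coeff (a ∷ p) (suc i) = coeff p i

  -- Coefficientwise equality: equivalent to _≈ₚ_ (see ≈ₚ⇔≋), and easier to reason with.
  infix 4 _≋_
  record _≋_ (p q : Pol) : Set where
    constructor mk≋
    field at : ∀ i → coeff p i ≡ coeff q i
  open _≋_ public

  ≋-refl : ∀ {p} → p ≋ p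
  ≋-refl = mk≋ λ _ → refl

  ≋-sym : ∀ {p q} → p ≋ q → q ≋ p
  ≋-sym p≋q = mk≋ λ i → sym (at p≋q i)

  ≋-trans : ∀ {p q r} → p ≋ q → q ≋ r → p ≋ r
  ≋-trans p≋q q≋r = mk≋ λ i → trans (at p≋q i) (at q≋r i)

  ∷-cong : ∀ {a b p q} → a ≡ b → p ≋ q → a ∷ p ≋ b ∷ q
  ∷-cong a≡b p≋q = mk≋ λ { zero → a≡b ; (suc i) → at p≋q i }

  ∷-injectiveˡ : ∀ {a b p q} → a ∷ p ≋ b ∷ q → a ≡ b
  ∷-injectiveˡ e = at e zero

  ∷-injectiveʳ : ∀ {a b p q} → a ∷ p ≋ b ∷ q → p ≋ q
  ∷-injectiveʳ e = mk≋ λ i → at e (suc i)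

  ∷-≋[] : ∀ {a p} → a ≡ 0# → p ≋ [] → a ∷ p ≋ []
  ∷-≋[] a≡0 p≋[] = mk≋ λ { zero → a≡0 ; (suc i) → at p≋[] i }

  ∷-≋[]⁻ : ∀ {a p} → a ∷ p ≋ [] → a ≡ 0# × p ≋ []
  ∷-≋[]⁻ a∷p≋[] = at a∷p≋[] zero , mk≋ λ i → at a∷p≋[] (suc i)

  infixr 25 _·ₚ_
  _·ₚ_ : Carrier → Pol → Pol
  a ·ₚ p = map (a *_) p

  coeff-+ₚ : ∀ p q i → coeff (p +ₚ q) i ≡ coeff p i + coeff q i
  coeff-+ₚ [] q i = sym (+-identityˡ _)
  coeff-+ₚ (a ∷ p) [] i = sym (+-identityʳ _)
  coeff-+ₚ (a ∷ p) (b ∷ q) zero = refl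
  coeff-+ₚ (a ∷ p) (b ∷ q) (suc i) = coeff-+ₚ p q i

  coeff-negₚ : ∀ p i → coeff (negₚ p) i ≡ - coeff p i
  coeff-negₚ [] i = sym -0#≈0#
  coeff-negₚ (a ∷ p) zero = refl
  coeff-negₚ (a ∷ p) (suc i) = coeff-negₚ p i

  coeff-·ₚ : ∀ a p i → coeff (a ·ₚ p) i ≡ a * coeff p i
  coeff-·ₚ a [] i = sym (zeroʳ a)
  coeff-·ₚ a (b ∷ p) zero = refl
  coeff-·ₚ a (b ∷ p) (suc i) = coeff-·ₚ a p i

  +ₚ-cong : ∀ {p p′ q q′} → p ≋ p′ → q ≋ q′ → p +ₚ q ≋ p′ +ₚ q′
  +ₚ-cong {p} {p′} {q} {q′} p≋p′ q≋q′ .at i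
    rewrite coeff-+ₚ p q i | coeff-+ₚ p′ q′ i | at p≋p′ i | at q≋q′ i = refl

  negₚ-cong : ∀ {p p′} → p ≋ p′ → negₚ p ≋ negₚ p′
  negₚ-cong {p} {p′} p≋p′ .at i rewrite coeff-negₚ p i | coeff-negₚ p′ i | at p≋p′ i = refl

  ·ₚ-cong : ∀ a {p p′} → p ≋ p′ → a ·ₚ p ≋ a ·ₚ p′
  ·ₚ-cong a {p} {p′} p≋p′ .at i rewrite coeff-·ₚ a p i | coeff-·ₚ a p′ i | at p≋p′ i = refl

  +ₚ-assoc : ∀ p q r → (p +ₚ q) +ₚ r ≋ p +ₚ (q +ₚ r)
  +ₚ-assoc p q r .at i
    rewrite coeff-+ₚ (p +ₚ q) r i | coeff-+ₚ p q i | coeff-+ₚ p (q +ₚ r) i | coeff-+ₚ q r i = +-assoc _ _ _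

  +ₚ-comm : ∀ p q → p +ₚ q ≋ q +ₚ p
  +ₚ-comm p q .at i rewrite coeff-+ₚ p q i | coeff-+ₚ q p i = +-comm _ _

  +ₚ-identityʳ : ∀ p → p +ₚ [] ≋ p
  +ₚ-identityʳ p .at i rewrite coeff-+ₚ p [] i = +-identityʳ _

  negₚ-inverseˡ : ∀ p → negₚ p +ₚ p ≋ []
  negₚ-inverseˡ p .at i rewrite coeff-+ₚ (negₚ p) p i | coeff-negₚ p i = -‿inverseˡ _

  negₚ-inverseʳ : ∀ p → p +ₚ negₚ p ≋ []
  negₚ-inverseʳ p .at i rewrite coeff-+ₚ p (negₚ p) i | coeff-negₚ p i = -‿inverseʳ _

  ·ₚ-distribˡ : ∀ a p q → a ·ₚ (p +ₚ q) ≋ a ·ₚ p +ₚ a ·ₚ q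
  ·ₚ-distribˡ a p q .at i
    rewrite coeff-·ₚ a (p +ₚ q) i | coeff-+ₚ p q i | coeff-+ₚ (a ·ₚ p) (a ·ₚ q) i | coeff-·ₚ a p i | coeff-·ₚ a q i =
    distribˡ a _ _

  ·ₚ-distribʳ : ∀ a b p → (a + b) ·ₚ p ≋ a ·ₚ p +ₚ b ·ₚ p
  ·ₚ-distribʳ a b p .at i
    rewrite coeff-·ₚ (a + b) p i | coeff-+ₚ (a ·ₚ p) (b ·ₚ p) i | coeff-·ₚ a p i | coeff-·ₚ b p i = distribʳ _ a b

  ·ₚ-assoc : ∀ a b p → a ·ₚ b ·ₚ p ≋ (a * b) ·ₚ p
  ·ₚ-assoc a b p .at i rewrite coeff-·ₚ a (b ·ₚ p) i | coeff-·ₚ b p i | coeff-·ₚ (a * b) p i = sym (*-assoc a b _)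

  ·ₚ-zeroˡ : ∀ p → 0# ·ₚ p ≋ []
  ·ₚ-zeroˡ p .at i rewrite coeff-·ₚ 0# p i = zeroˡ _

  ·ₚ-identityˡ : ∀ p → 1# ·ₚ p ≋ p
  ·ₚ-identityˡ p .at i rewrite coeff-·ₚ 1# p i = *-identityˡ _

  +ₚ-interchange : ∀ p q r s → (p +ₚ q) +ₚ (r +ₚ s) ≋ (p +ₚ r) +ₚ (q +ₚ s)
  +ₚ-interchange p q r s .at i
    rewrite coeff-+ₚ (p +ₚ q) (r +ₚ s) i | coeff-+ₚ p q i | coeff-+ₚ r s i
          | coeff-+ₚ (p +ₚ r) (q +ₚ s) i | coeff-+ₚ p r i | coeff-+ₚ q s i = +-interchange _ _ _ _

  +ₚ-left-comm : ∀ p q r → p +ₚ (q +ₚ r) ≋ q +ₚ (p +ₚ r)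
  +ₚ-left-comm p q r .at i
    rewrite coeff-+ₚ p (q +ₚ r) i | coeff-+ₚ q r i | coeff-+ₚ q (p +ₚ r) i | coeff-+ₚ p r i = x+[y+z]≡y+[x+z] _ _ _

  0∷-+ₚ : ∀ p q → 0# ∷ (p +ₚ q) ≋ (0# ∷ p) +ₚ (0# ∷ q)
  0∷-+ₚ p q = ∷-cong (sym (+-identityʳ 0#)) ≋-refl

  *ₚ-zeroʳ : ∀ p → p *ₚ [] ≋ []
  *ₚ-zeroʳ [] = ≋-refl
  *ₚ-zeroʳ (a ∷ p) = ∷-≋[] refl (*ₚ-zeroʳ p)

  *ₚ-zeroˡ : ∀ {p} q → p ≋ [] → p *ₚ q ≋ []
  *ₚ-zeroˡ {[]} q _ = ≋-refl
  *ₚ-zeroˡ {a ∷ p} q a∷p≋[] with refl , p≋[] ← ∷-≋[]⁻ a∷p≋[] =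
    ≋-trans (+ₚ-cong (·ₚ-zeroˡ q) (∷-≋[] refl (*ₚ-zeroˡ q p≋[]))) (+ₚ-identityʳ [])

  *ₚ-congʳ : ∀ p {q q′} → q ≋ q′ → p *ₚ q ≋ p *ₚ q′
  *ₚ-congʳ [] _ = ≋-refl
  *ₚ-congʳ (a ∷ p) q≋q′ = +ₚ-cong (·ₚ-cong a q≋q′) (∷-cong refl (*ₚ-congʳ p q≋q′))

  *ₚ-congˡ : ∀ {p p′} q → p ≋ p′ → p *ₚ q ≋ p′ *ₚ q
  *ₚ-congˡ {[]} q p≋p′ = ≋-sym (*ₚ-zeroˡ q (≋-sym p≋p′))
  *ₚ-congˡ {a ∷ p} {[]} q p≋p′ = *ₚ-zeroˡ q p≋p′
  *ₚ-congˡ {a ∷ p} {b ∷ p′} q p≋p′ with refl ← ∷-injectiveˡ p≋p′ =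
    +ₚ-cong ≋-refl (∷-cong refl (*ₚ-congˡ q (∷-injectiveʳ p≋p′)))

  *ₚ-cong : ∀ {p p′ q q′} → p ≋ p′ → q ≋ q′ → p *ₚ q ≋ p′ *ₚ q′
  *ₚ-cong {p′ = p′} {q} p≋p′ q≋q′ = ≋-trans (*ₚ-congˡ q p≋p′) (*ₚ-congʳ p′ q≋q′)

  [a]*ₚ : ∀ a q → (a ∷ []) *ₚ q ≋ a ·ₚ q
  [a]*ₚ a q = ≋-trans (+ₚ-cong ≋-refl (∷-≋[] refl ≋-refl)) (+ₚ-identityʳ _)

  ·ₚ-*ₚ : ∀ a p q → (a ·ₚ p) *ₚ q ≋ a ·ₚ (p *ₚ q)
  ·ₚ-*ₚ a [] q = ≋-refl
  ·ₚ-*ₚ a (b ∷ p) q = ≋-trans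
    (+ₚ-cong (≋-sym (·ₚ-assoc a b q)) (∷-cong (sym (zeroʳ a)) (·ₚ-*ₚ a p q)))
    (≋-sym (·ₚ-distribˡ a (b ·ₚ q) (0# ∷ (p *ₚ q))))

  0∷-*ₚ : ∀ p q → (0# ∷ p) *ₚ q ≋ 0# ∷ (p *ₚ q)
  0∷-*ₚ p q = +ₚ-cong (·ₚ-zeroˡ q) ≋-refl

  *ₚ-distribʳ : ∀ p q r → (p +ₚ q) *ₚ r ≋ (p *ₚ r) +ₚ (q *ₚ r)
  *ₚ-distribʳ [] q r = ≋-refl
  *ₚ-distribʳ (a ∷ p) [] r = ≋-sym (+ₚ-identityʳ _)
  *ₚ-distribʳ (a ∷ p) (b ∷ q) r = ≋-trans
    (+ₚ-cong (·ₚ-distribʳ a b r) (≋-trans (∷-cong refl (*ₚ-distribʳ p q r)) (0∷-+ₚ (p *ₚ r) (q *ₚ r))))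
    (+ₚ-interchange (a ·ₚ r) (b ·ₚ r) (0# ∷ (p *ₚ r)) (0# ∷ (q *ₚ r)))

  *ₚ-distribˡ : ∀ p q r → p *ₚ (q +ₚ r) ≋ (p *ₚ q) +ₚ (p *ₚ r)
  *ₚ-distribˡ [] q r = ≋-refl
  *ₚ-distribˡ (a ∷ p) q r = ≋-trans
    (+ₚ-cong (·ₚ-distribˡ a q r) (≋-trans (∷-cong refl (*ₚ-distribˡ p q r)) (0∷-+ₚ (p *ₚ q) (p *ₚ r))))
    (+ₚ-interchange (a ·ₚ q) (a ·ₚ r) (0# ∷ (p *ₚ q)) (0# ∷ (p *ₚ r)))

  *ₚ-∷ : ∀ p b q → p *ₚ (b ∷ q) ≋ b ·ₚ p +ₚ (0# ∷ (p *ₚ q))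
  *ₚ-∷ [] b q = ≋-sym (∷-≋[] refl ≋-refl)
  *ₚ-∷ (a ∷ p) b q = ∷-cong (cong (_+ 0#) (*-comm a b))
    (≋-trans (+ₚ-cong (≋-refl {a ·ₚ q}) (*ₚ-∷ p b q)) (+ₚ-left-comm (a ·ₚ q) (b ·ₚ p) (0# ∷ (p *ₚ q))))

  *ₚ-comm : ∀ p q → p *ₚ q ≋ q *ₚ p
  *ₚ-comm [] q = ≋-sym (*ₚ-zeroʳ q)
  *ₚ-comm (a ∷ p) q = ≋-trans (+ₚ-cong ≋-refl (∷-cong refl (*ₚ-comm p q))) (≋-sym (*ₚ-∷ q a p))

  *ₚ-assoc : ∀ p q r → (p *ₚ q) *ₚ r ≋ p *ₚ (q *ₚ r)
  *ₚ-assoc [] q r = ≋-refl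
  *ₚ-assoc (a ∷ p) q r = ≋-trans (*ₚ-distribʳ (a ·ₚ q) (0# ∷ (p *ₚ q)) r)
    (+ₚ-cong (·ₚ-*ₚ a q r) (≋-trans (0∷-*ₚ (p *ₚ q) r) (∷-cong refl (*ₚ-assoc p q r))))

  *ₚ-identityˡ : ∀ p → 1ₚ *ₚ p ≋ p
  *ₚ-identityˡ p = ≋-trans ([a]*ₚ 1# p) (·ₚ-identityˡ p)

  *ₚ-identityʳ : ∀ p → p *ₚ 1ₚ ≋ p
  *ₚ-identityʳ p = ≋-trans (*ₚ-comm p 1ₚ) (*ₚ-identityˡ p)

  polynomialRing : CommutativeRing 0ℓ 0ℓ
  polynomialRing = record
    { Carrier = Pol ; _≈_ = _≋_ ; _+_ = _+ₚ_ ; _*_ = _*ₚ_ ; -_ = negₚ ; 0# = [] ; 1# = 1ₚ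
    ; isCommutativeRing = record
      { isRing = record
        { +-isAbelianGroup = record
          { isGroup = record
            { isMonoid = record
              { isSemigroup = record
                { isMagma = record
                  { isEquivalence = record { refl = ≋-refl ; sym = ≋-sym ; trans = ≋-trans }
                  ; ∙-cong = +ₚ-cong }
                ; assoc = +ₚ-assoc }
              ; identity = (λ _ → ≋-refl) , +ₚ-identityʳ }
            ; inverse = negₚ-inverseˡ , negₚ-inverseʳ
            ; ⁻¹-cong = negₚ-cong }
          ; comm = +ₚ-comm }
        ; *-cong = *ₚ-cong
        ; *-assoc = *ₚ-assoc
        ; *-identity = *ₚ-identityˡ , *ₚ-identityʳ
        ; distrib = *ₚ-distribˡ , λ r p q → *ₚ-distribʳ p q r }
      ; *-comm = *ₚ-comm } }

  module ≋-Reasoning = SetoidReasoning (CommutativeRing.setoid polynomialRing)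

  open IntegerCoefficientSolver polynomialRing using (solve; _:=_; _:+_; _:-_)

  ≡⇒≋ : ∀ {p q} → p ≡ q → p ≋ q
  ≡⇒≋ refl = ≋-refl

  diff≋[]⇒≋ : ∀ {p q} → p +ₚ negₚ q ≋ [] → p ≋ q
  diff≋[]⇒≋ {p} {q} p-q≋0 = ≋-trans (solve 2 (λ p q → p := (p :- q) :+ q) ≋-refl p q) (+ₚ-cong p-q≋0 ≋-refl)

  All≡0⇔≋[] : ∀ p → All (_≡ 0#) p ⇔ p ≋ []
  All≡0⇔≋[] p = mk⇔ (to p) (from p)
    where
      to : ∀ p → All (_≡ 0#) p → p ≋ []
      to [] [] = ≋-refl
      to (a ∷ p) (a≡0 ∷ p≡0) = ∷-≋[] a≡0 (to p p≡0)
      from : ∀ p → p ≋ [] → All (_≡ 0#) p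
      from [] _ = []
      from (a ∷ p) a∷p≋[] = proj₁ (∷-≋[]⁻ a∷p≋[]) ∷ from p (proj₂ (∷-≋[]⁻ a∷p≋[]))

  ≈ₚ⇔≋ : ∀ p q → p ≈ₚ q ⇔ p ≋ q
  ≈ₚ⇔≋ p q = mk⇔ (diff≋[]⇒≋ ∘ to) (from ∘ λ p≋q → ≋-trans (+ₚ-cong p≋q ≋-refl) (negₚ-inverseʳ q))
    where open Equivalence (All≡0⇔≋[] (p +ₚ negₚ q))

module Division (F : FiniteField) where
  open import Data.List using (_++_; [_]; drop)
  open import Data.Vec using (zipWith; initLast; _∷ʳ_)
  open FiniteField F using (Carrier)
  open Poly F
  open PolynomialRing F
  open IntegerCoefficientSolver polynomialRing using (solve; _:=_; _:+_; _:*_; _:-_; :-_; con)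

  ⌜_⌝ : ∀ {n} → Vec Carrier n → Pol
  ⌜_⌝ {n} c = monic n c

  DegreeBelow : ℕ → Pol → Set
  DegreeBelow n p = ∀ i → n ≤ i → coeff p i ≡ 0#

  toList-degreeBelow : ∀ {n} (u : Vec Carrier n) → DegreeBelow n (toList u)
  toList-degreeBelow [] i _ = refl
  toList-degreeBelow (x ∷ u) (suc i) (s≤s n≤i) = toList-degreeBelow u i n≤i

  ⌜⌝-degreeBelow : ∀ {n} (c : Vec Carrier n) → DegreeBelow (suc n) ⌜ c ⌝
  ⌜⌝-degreeBelow [] (suc zero) _ = refl
  ⌜⌝-degreeBelow [] (suc (suc i)) _ = refl
  ⌜⌝-degreeBelow (x ∷ c) (suc i) (s≤s n<i) = ⌜⌝-degreeBelow c i n<i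

  coeff-⌜⌝-top : ∀ {n} (c : Vec Carrier n) → coeff ⌜ c ⌝ n ≡ 1#
  coeff-⌜⌝-top [] = refl
  coeff-⌜⌝-top (x ∷ c) = coeff-⌜⌝-top c

  degreeBelow-mono : ∀ {m n} p → m ≤ n → DegreeBelow m p → DegreeBelow n p
  degreeBelow-mono p m≤n p<m i n≤i = p<m i (ℕ.≤-trans m≤n n≤i)

  degreeBelow-·ₚ : ∀ {n} a p → DegreeBelow n p → DegreeBelow n (a ·ₚ p)
  degreeBelow-·ₚ a p p<n i n≤i = trans (coeff-·ₚ a p i) (trans (cong (a *_) (p<n i n≤i)) (zeroʳ a))

  degreeBelow-− : ∀ {n} p q → DegreeBelow n p → DegreeBelow n q → DegreeBelow n (p +ₚ negₚ q)
  degreeBelow-− p q p<n q<n i n≤i = begin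
    coeff (p +ₚ negₚ q) i          ≡⟨ coeff-+ₚ p (negₚ q) i ⟩
    coeff p i + coeff (negₚ q) i   ≡⟨ cong₂ _+_ (p<n i n≤i) (trans (coeff-negₚ q i) (cong -_ (q<n i n≤i))) ⟩
    0# + - 0#                      ≡⟨ -‿inverseʳ 0# ⟩
    0#                             ∎
    where open ≡-Reasoning

  degreeBelow-tail : ∀ {n} p → DegreeBelow (suc n) p → DegreeBelow n (drop 1 p)
  degreeBelow-tail [] _ _ _ = refl
  degreeBelow-tail (a ∷ p) p<1+n i n≤i = p<1+n (suc i) (s≤s n≤i)

  ≋-tail : ∀ {a p q} → a ∷ p ≋ q → p ≋ drop 1 q
  ≋-tail {q = []} e = mk≋ λ i → at e (suc i)
  ≋-tail {q = b ∷ q} e = mk≋ λ i → at e (suc i)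

  degreeBelow-multiple : ∀ {n} (c : Vec Carrier n) s {t} → s *ₚ ⌜ c ⌝ ≋ t → DegreeBelow n t → s ≋ []
  degreeBelow-multiple c [] _ _ = ≋-refl
  degreeBelow-multiple {n} c (a ∷ s) {t} as*c≋t t<n = ∷-≋[] a≡0 s≋[]
    where
      s*c≋ : s *ₚ ⌜ c ⌝ ≋ drop 1 (t +ₚ negₚ (a ·ₚ ⌜ c ⌝))
      s*c≋ = ≋-tail (≋-trans (solve 2 (λ X Y → X := (Y :+ X) :- Y) ≋-refl (0# ∷ (s *ₚ ⌜ c ⌝)) (a ·ₚ ⌜ c ⌝))
                             (+ₚ-cong as*c≋t ≋-refl))
      s≋[] : s ≋ []
      s≋[] = degreeBelow-multiple c s s*c≋
        (degreeBelow-tail (t +ₚ negₚ (a ·ₚ ⌜ c ⌝))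
          (degreeBelow-− t (a ·ₚ ⌜ c ⌝) (degreeBelow-mono t (ℕ.n≤1+n n) t<n) (degreeBelow-·ₚ a ⌜ c ⌝ (⌜⌝-degreeBelow c))))
      a≡0 : a ≡ 0#
      a≡0 = begin
        a                             ≡⟨ *-identityʳ a ⟨
        a * 1#                        ≡⟨ cong (a *_) (coeff-⌜⌝-top c) ⟨
        a * coeff ⌜ c ⌝ n             ≡⟨ coeff-·ₚ a ⌜ c ⌝ n ⟨
        coeff (a ·ₚ ⌜ c ⌝) n          ≡⟨ at ([a]*ₚ a ⌜ c ⌝) n ⟨
        coeff ((a ∷ []) *ₚ ⌜ c ⌝) n   ≡⟨ at (*ₚ-congˡ ⌜ c ⌝ (∷-cong refl s≋[])) n ⟨
        coeff ((a ∷ s) *ₚ ⌜ c ⌝) n    ≡⟨ at as*c≋t n ⟩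
        coeff t n                     ≡⟨ t<n n ℕ.≤-refl ⟩
        0#                            ∎
        where open ≡-Reasoning

  coeffs : ∀ n → Pol → Vec Carrier n
  coeffs zero p = []
  coeffs (suc n) [] = 0# ∷ coeffs n []
  coeffs (suc n) (x ∷ p) = x ∷ coeffs n p

  toList-coeffs : ∀ n p → DegreeBelow n p → toList (coeffs n p) ≋ p
  toList-coeffs zero p p<0 = mk≋ λ i → sym (p<0 i z≤n)
  toList-coeffs (suc n) [] _ = ∷-≋[] refl (toList-coeffs n [] λ _ _ → refl)
  toList-coeffs (suc n) (x ∷ p) p<1+n = ∷-cong refl (toList-coeffs n p λ i n≤i → p<1+n (suc i) (s≤s n≤i))

  toList-injective : ∀ {n} (u v : Vec Carrier n) → toList u ≋ toList v → u ≡ v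
  toList-injective [] [] _ = refl
  toList-injective (x ∷ u) (y ∷ v) e = cong₂ _∷_ (∷-injectiveˡ e) (toList-injective u v (∷-injectiveʳ e))

  toList-replicate-0 : ∀ n → toList (replicate n 0#) ≋ []
  toList-replicate-0 zero = ≋-refl
  toList-replicate-0 (suc n) = ∷-≋[] refl (toList-replicate-0 n)

  private
    reduce-top : ∀ {n} t (r c : Vec Carrier n) →
                 toList r ++ [ t ] ≋ toList (zipWith (λ x y → x + - (t * y)) r c) +ₚ t ·ₚ ⌜ c ⌝
    reduce-top t [] [] = ∷-cong (sym (*-identityʳ t)) ≋-refl
    reduce-top t (x ∷ r) (y ∷ c) = ∷-cong (x≡x-z+z x (t * y)) (reduce-top t r c)
      where
        x≡x-z+z : ∀ x z → x ≡ (x + - z) + z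
        x≡x-z+z x z = sym (trans (+-assoc x (- z) z) (trans (cong (x +_) (-‿inverseˡ z)) (+-identityʳ x)))

  divMod : ∀ {n} (c : Vec Carrier n) p → Σ Pol λ q → Σ (Vec Carrier n) λ r → p ≋ (q *ₚ ⌜ c ⌝) +ₚ toList r
  divMod [] p = p , [] , ≋-sym (≋-trans (+ₚ-identityʳ _) (*ₚ-identityʳ p))
  divMod c@(_ ∷ _) [] = [] , replicate _ 0# , ≋-sym (toList-replicate-0 _)
  divMod c@(_ ∷ _) (a ∷ p) with divMod c p
  ... | q , r , p≋ with initLast (a ∷ r)
  ...   | r′ , t , a∷r≡r′∷ʳt = t ∷ q , zipWith (λ x y → x + - (t * y)) r′ c , (begin
    a ∷ p
      ≈⟨ ∷-cong refl p≋ ⟩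
    a ∷ ((q *ₚ ⌜ c ⌝) +ₚ toList r)
      ≈⟨ mk≋ (λ { zero → sym (+-identityʳ a) ; (suc i) → at (+ₚ-comm (q *ₚ ⌜ c ⌝) (toList r)) i }) ⟩
    toList (a ∷ r) +ₚ (0# ∷ (q *ₚ ⌜ c ⌝))
      ≡⟨ cong (λ v → toList v +ₚ (0# ∷ (q *ₚ ⌜ c ⌝))) a∷r≡r′∷ʳt ⟩
    toList (r′ ∷ʳ t) +ₚ (0# ∷ (q *ₚ ⌜ c ⌝))
      ≡⟨ cong (_+ₚ (0# ∷ (q *ₚ ⌜ c ⌝))) (Vec.toList-∷ʳ t r′) ⟩
    (toList r′ ++ [ t ]) +ₚ (0# ∷ (q *ₚ ⌜ c ⌝))
      ≈⟨ +ₚ-cong (reduce-top t r′ c) ≋-refl ⟩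
    (R +ₚ t ·ₚ ⌜ c ⌝) +ₚ (0# ∷ (q *ₚ ⌜ c ⌝))
      ≈⟨ solve 3 (λ R T Q → (R :+ T) :+ Q := (T :+ Q) :+ R) ≋-refl R (t ·ₚ ⌜ c ⌝) (0# ∷ (q *ₚ ⌜ c ⌝)) ⟩
    ((t ∷ q) *ₚ ⌜ c ⌝) +ₚ R ∎)
    where
      R = toList (zipWith (λ x y → x + - (t * y)) r′ c)
      open ≋-Reasoning

  quot : ∀ {n} → Vec Carrier n → Pol → Pol
  quot c p = proj₁ (divMod c p)

  rem : ∀ {n} → Vec Carrier n → Pol → Vec Carrier n
  rem c p = proj₁ (proj₂ (divMod c p))

  divMod-≋ : ∀ {n} (c : Vec Carrier n) p → p ≋ (quot c p *ₚ ⌜ c ⌝) +ₚ toList (rem c p)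
  divMod-≋ c p = proj₂ (proj₂ (divMod c p))

  rem-unique : ∀ {n} (c : Vec Carrier n) {p} k (u : Vec Carrier n) → p ≋ (k *ₚ ⌜ c ⌝) +ₚ toList u → rem c p ≡ u
  rem-unique {n} c {p} k u p≋ = toList-injective (rem c p) u (diff≋[]⇒≋ r-u≋0)
    where
      Q = quot c p
      r = toList (rem c p)
      [k-Q]*c≋r-u : (k +ₚ negₚ Q) *ₚ ⌜ c ⌝ ≋ r +ₚ negₚ (toList u)
      [k-Q]*c≋r-u = ≋-trans
        (solve 5 (λ k Q m u r → (k :- Q) :* m := ((k :* m :+ u) :- (Q :* m :+ r)) :+ (r :- u)) ≋-refl k Q ⌜ c ⌝ (toList u) r)
        (+ₚ-cong (≋-trans (+ₚ-cong (≋-sym p≋) (negₚ-cong (≋-sym (divMod-≋ c p)))) (negₚ-inverseʳ p)) ≋-refl)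
      r-u≋0 : r +ₚ negₚ (toList u) ≋ []
      r-u≋0 = ≋-trans (≋-sym [k-Q]*c≋r-u) (*ₚ-zeroˡ ⌜ c ⌝ (degreeBelow-multiple c (k +ₚ negₚ Q) [k-Q]*c≋r-u
                (degreeBelow-− r (toList u) (toList-degreeBelow (rem c p)) (toList-degreeBelow u))))

  rem-toList : ∀ {n} (c u : Vec Carrier n) → rem c (toList u) ≡ u
  rem-toList c u = rem-unique c [] u ≋-refl

  degreeBelow-*ₚ : ∀ {a b} p q → DegreeBelow (suc a) p → DegreeBelow b q → DegreeBelow (a ℕ.+ b) (p *ₚ q)
  degreeBelow-*ₚ [] q _ _ _ _ = refl
  degreeBelow-*ₚ {a} {b} (c ∷ p) q c∷p<1+a q<b i a+b≤i =
    trans (coeff-+ₚ (c ·ₚ q) (0# ∷ (p *ₚ q)) i)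
      (trans (cong₂ _+_ (degreeBelow-·ₚ c q q<b i (ℕ.≤-trans (ℕ.m≤n+m b a) a+b≤i)) (shifted-vanishes a i c∷p<1+a a+b≤i))
             (+-identityʳ 0#))
    where
      shifted-vanishes : ∀ a i → DegreeBelow (suc a) (c ∷ p) → a ℕ.+ b ≤ i → coeff (0# ∷ (p *ₚ q)) i ≡ 0#
      shifted-vanishes _ zero _ _ = refl
      shifted-vanishes zero (suc i) c∷p<1 _ = at (*ₚ-zeroˡ {p} q (mk≋ λ j → c∷p<1 (suc j) (s≤s z≤n))) i
      shifted-vanishes (suc a) (suc i) c∷p<2+a (s≤s a+b≤i) =
        degreeBelow-*ₚ p q (λ j a≤j → c∷p<2+a (suc j) (s≤s a≤j)) q<b i a+b≤i

  ⌜⌝-*ₚ-cancelˡ : ∀ {n} (c : Vec Carrier n) s s′ → ⌜ c ⌝ *ₚ s ≋ ⌜ c ⌝ *ₚ s′ → s ≋ s′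
  ⌜⌝-*ₚ-cancelˡ c s s′ cs≋cs′ = diff≋[]⇒≋ (degreeBelow-multiple c (s +ₚ negₚ s′) [s-s′]*c≋0 λ _ _ → refl)
    where
      [s-s′]*c≋0 : (s +ₚ negₚ s′) *ₚ ⌜ c ⌝ ≋ []
      [s-s′]*c≋0 = ≋-trans (solve 3 (λ s s′ c → (s :- s′) :* c := c :* s :- c :* s′) ≋-refl s s′ ⌜ c ⌝)
                           (≋-trans (+ₚ-cong cs≋cs′ ≋-refl) (negₚ-inverseʳ (⌜ c ⌝ *ₚ s′)))

module Divisibility (F : FiniteField) where
  open FiniteField F using (Carrier)
  open Poly F
  open PolynomialRing F
  open Division F
  open IntegerCoefficientSolver polynomialRing using (solve; _:=_; _:+_; _:*_; _:-_; :-_)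

  infix 4 _∣ₚ_
  _∣ₚ_ : Pol → Pol → Set
  m ∣ₚ p = Σ Pol λ k → p ≋ k *ₚ m

  ∣ₚ-refl : ∀ {m} → m ∣ₚ m
  ∣ₚ-refl {m} = 1ₚ , ≋-sym (*ₚ-identityˡ m)

  ∣ₚ-trans : ∀ {a b c} → a ∣ₚ b → b ∣ₚ c → a ∣ₚ c
  ∣ₚ-trans {a} (k , b≋ka) (l , c≋lb) = l *ₚ k , ≋-trans c≋lb (≋-trans (*ₚ-congʳ l b≋ka) (≋-sym (*ₚ-assoc l k a)))

  ∣ₚ-respʳ : ∀ {m p p′} → p ≋ p′ → m ∣ₚ p → m ∣ₚ p′
  ∣ₚ-respʳ p≋p′ (k , p≋km) = k , ≋-trans (≋-sym p≋p′) p≋km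

  ∣ₚ-respˡ : ∀ {m m′ p} → m ≋ m′ → m ∣ₚ p → m′ ∣ₚ p
  ∣ₚ-respˡ m≋m′ (k , p≋km) = k , ≋-trans p≋km (*ₚ-congʳ k m≋m′)

  ∣ₚ-*ˡ : ∀ {a b} c → a ∣ₚ b → a ∣ₚ c *ₚ b
  ∣ₚ-*ˡ {a} c (k , b≋ka) = c *ₚ k , ≋-trans (*ₚ-congʳ c b≋ka) (≋-sym (*ₚ-assoc c k a))

  ∣ₚ-*ʳ : ∀ {a b} c → a ∣ₚ b → a ∣ₚ b *ₚ c
  ∣ₚ-*ʳ {b = b} c a∣b = ∣ₚ-respʳ (*ₚ-comm c b) (∣ₚ-*ˡ c a∣b)

  ∣ₚ-+ₚ : ∀ {a b c} → a ∣ₚ b → a ∣ₚ c → a ∣ₚ b +ₚ c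
  ∣ₚ-+ₚ {a} (k , b≋ka) (l , c≋la) = k +ₚ l , ≋-trans (+ₚ-cong b≋ka c≋la) (≋-sym (*ₚ-distribʳ k l a))

  ∣ₚ⇒rem≡0 : ∀ {n} (c : Vec Carrier n) {p} → ⌜ c ⌝ ∣ₚ p → rem c p ≡ replicate n 0#
  ∣ₚ⇒rem≡0 {n} c (k , p≋kc) =
    rem-unique c k (replicate n 0#) (≋-trans p≋kc (≋-sym (≋-trans (+ₚ-cong ≋-refl (toList-replicate-0 n)) (+ₚ-identityʳ _))))

  rem≡0⇒∣ₚ : ∀ {n} (c : Vec Carrier n) {p} → rem c p ≡ replicate n 0# → ⌜ c ⌝ ∣ₚ p
  rem≡0⇒∣ₚ {n} c {p} r≡0 = quot c p , ≋-trans (divMod-≋ c p)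
    (≋-trans (+ₚ-cong ≋-refl (≋-trans (≡⇒≋ (cong toList r≡0)) (toList-replicate-0 n))) (+ₚ-identityʳ _))

  _∣ₚ?_ : ∀ {n} (c : Vec Carrier n) p → Dec (⌜ c ⌝ ∣ₚ p)
  c ∣ₚ? p = map′ (rem≡0⇒∣ₚ c) (∣ₚ⇒rem≡0 c) (Vec.≡-dec _≟_ (rem c p) (replicate _ 0#))

  rem≡⇒∣ₚ : ∀ {n} (c : Vec Carrier n) {p p′} → rem c p ≡ rem c p′ → ⌜ c ⌝ ∣ₚ p +ₚ negₚ p′
  rem≡⇒∣ₚ c {p} {p′} rp≡rp′ = quot c p +ₚ negₚ (quot c p′) , (begin
    p +ₚ negₚ p′
      ≈⟨ +ₚ-cong (divMod-≋ c p) (negₚ-cong (divMod-≋ c p′)) ⟩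
    ((Q *ₚ ⌜ c ⌝) +ₚ R) +ₚ negₚ ((Q′ *ₚ ⌜ c ⌝) +ₚ toList (rem c p′))
      ≡⟨ cong (λ r → ((Q *ₚ ⌜ c ⌝) +ₚ R) +ₚ negₚ ((Q′ *ₚ ⌜ c ⌝) +ₚ toList r)) (sym rp≡rp′) ⟩
    ((Q *ₚ ⌜ c ⌝) +ₚ R) +ₚ negₚ ((Q′ *ₚ ⌜ c ⌝) +ₚ R)
      ≈⟨ solve 4 (λ Q Q′ c R → (Q :* c :+ R) :- (Q′ :* c :+ R) := (Q :- Q′) :* c) ≋-refl Q Q′ ⌜ c ⌝ R ⟩
    (Q +ₚ negₚ Q′) *ₚ ⌜ c ⌝ ∎)
    where
      open ≋-Reasoning
      Q = quot c p
      Q′ = quot c p′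
      R = toList (rem c p)

  ∣ₚ⇒rem≡ : ∀ {n} (c : Vec Carrier n) {p p′} → ⌜ c ⌝ ∣ₚ p +ₚ negₚ p′ → rem c p ≡ rem c p′
  ∣ₚ⇒rem≡ c {p} {p′} (t , p-p′≋tc) = rem-unique c (t +ₚ quot c p′) (rem c p′)
    (≋-trans (solve 2 (λ p p′ → p := (p :- p′) :+ p′) ≋-refl p p′)
    (≋-trans (+ₚ-cong p-p′≋tc (divMod-≋ c p′))
    (solve 4 (λ t c Q R → t :* c :+ (Q :* c :+ R) := (t :+ Q) :* c :+ R) ≋-refl t ⌜ c ⌝ (quot c p′) (toList (rem c p′)))))

  rem-rem : ∀ {m n} (c : Vec Carrier m) (d : Vec Carrier n) → ⌜ c ⌝ ∣ₚ ⌜ d ⌝ → ∀ p → rem c (toList (rem d p)) ≡ rem c p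
  rem-rem c d c∣d p = ∣ₚ⇒rem≡ c (∣ₚ-respʳ -Qd≋R-p (∣ₚ-*ˡ (negₚ Q) c∣d))
    where
      Q = quot d p
      -Qd≋R-p : negₚ Q *ₚ ⌜ d ⌝ ≋ toList (rem d p) +ₚ negₚ p
      -Qd≋R-p = ≋-trans (solve 3 (λ Q d R → (:- Q) :* d := R :- (Q :* d :+ R)) ≋-refl Q ⌜ d ⌝ (toList (rem d p)))
                        (+ₚ-cong ≋-refl (negₚ-cong (≋-sym (divMod-≋ d p))))

module Monic (F : FiniteField) where
  open import Data.Vec using (fromList; zipWith)
  open FiniteField F using (Carrier)
  open Poly F
  open PolynomialRing F
  open Division F
  open Divisibility F

  ⌜⌝≉[] : ∀ {n} (c : Vec Carrier n) → ¬ ⌜ c ⌝ ≋ []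
  ⌜⌝≉[] c c≋[] = 1≢0 (trans (sym (coeff-⌜⌝-top c)) (at c≋[] _))

  Monic : Set
  Monic = Σ ℕ (Vec Carrier)

  deg : Monic → ℕ
  deg = proj₁

  ⟦_⟧ : Monic → Pol
  ⟦ _ , c ⟧ = ⌜ c ⌝

  1ᵐ : Monic
  1ᵐ = 0 , []

  private
    ⌜zipWith+⌝ : ∀ {n} (u v : Vec Carrier n) → ⌜ zipWith _+_ u v ⌝ ≋ toList u +ₚ ⌜ v ⌝
    ⌜zipWith+⌝ [] [] = ≋-refl
    ⌜zipWith+⌝ (a ∷ u) (b ∷ v) = ∷-cong refl (⌜zipWith+⌝ u v)

    lower-* : ∀ {d e} → Vec Carrier d → Vec Carrier e → Vec Carrier (d ℕ.+ e)
    lower-* [] w = w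
    lower-* {suc d} {e} (a ∷ u) w = zipWith _+_ (coeffs (suc (d ℕ.+ e)) (a ·ₚ ⌜ w ⌝)) (0# ∷ lower-* u w)

    ⌜lower-*⌝ : ∀ {d e} (u : Vec Carrier d) (w : Vec Carrier e) → ⌜ lower-* u w ⌝ ≋ ⌜ u ⌝ *ₚ ⌜ w ⌝
    ⌜lower-*⌝ [] w = ≋-sym (*ₚ-identityˡ ⌜ w ⌝)
    ⌜lower-*⌝ {suc d} {e} (a ∷ u) w = ≋-trans (⌜zipWith+⌝ (coeffs (suc (d ℕ.+ e)) (a ·ₚ ⌜ w ⌝)) (0# ∷ lower-* u w))
      (+ₚ-cong (toList-coeffs _ (a ·ₚ ⌜ w ⌝)
                 (degreeBelow-·ₚ a ⌜ w ⌝ (degreeBelow-mono ⌜ w ⌝ (s≤s (ℕ.m≤n+m e d)) (⌜⌝-degreeBelow w))))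
               (∷-cong refl (⌜lower-*⌝ u w)))

  infixl 7 _*ᵐ_
  _*ᵐ_ : Monic → Monic → Monic
  (d , u) *ᵐ (e , w) = d ℕ.+ e , lower-* u w

  ⟦*ᵐ⟧ : ∀ f g → ⟦ f *ᵐ g ⟧ ≋ ⟦ f ⟧ *ₚ ⟦ g ⟧
  ⟦*ᵐ⟧ (d , u) (e , w) = ⌜lower-*⌝ u w

  infixr 8 _^ᵐ_
  _^ᵐ_ : Monic → ℕ → Monic
  f ^ᵐ zero = 1ᵐ
  f ^ᵐ suc n = f *ᵐ f ^ᵐ n

  deg-^ᵐ : ∀ f n → deg (f ^ᵐ n) ≡ n ℕ.* deg f
  deg-^ᵐ f zero = refl
  deg-^ᵐ f (suc n) = cong (deg f ℕ.+_) (deg-^ᵐ f n)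

  private
    ·ₚ⌜⌝-top : ∀ {n} b (w : Vec Carrier n) → coeff (b ·ₚ ⌜ w ⌝) n ≡ b
    ·ₚ⌜⌝-top b w = trans (coeff-·ₚ b ⌜ w ⌝ _) (trans (cong (b *_) (coeff-⌜⌝-top w)) (*-identityʳ b))

    a*[x*a⁻¹]≡x : ∀ a (a≢0 : a ≢ 0#) x → a * (x * inv a a≢0) ≡ x
    a*[x*a⁻¹]≡x a a≢0 x =
      trans (cong (a *_) (*-comm x _)) (trans (sym (*-assoc a _ x)) (trans (cong (_* x) (*-inverseʳ a a≢0)) (*-identityˡ x)))

  scaledMonic : ∀ {n} (r : Vec Carrier n) → r ≢ replicate n 0# →
                Σ Carrier λ a → a ≢ 0# × Σ ℕ λ e → e < n × Σ (Vec Carrier e) λ w → toList r ≋ a ·ₚ ⌜ w ⌝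
  scaledMonic [] r≢0 = ⊥-elim (r≢0 refl)
  scaledMonic {suc n} (x ∷ r) x∷r≢0 with Vec.≡-dec _≟_ r (replicate n 0#)
  ... | yes refl = x , (λ { refl → x∷r≢0 refl }) , 0 , s≤s z≤n , [] , ∷-cong (sym (*-identityʳ x)) (toList-replicate-0 n)
  ... | no r≢0 with scaledMonic r r≢0
  ...   | a , a≢0 , e , e<n , w , r≋aw =
    a , a≢0 , suc e , s≤s e<n , x * inv a a≢0 ∷ w , ∷-cong (sym (a*[x*a⁻¹]≡x a a≢0 x)) r≋aw

  zero⊎scaledMonic : ∀ p → p ≋ [] ⊎ Σ Carrier λ a → a ≢ 0# × Σ Monic λ w → p ≋ a ·ₚ ⟦ w ⟧
  zero⊎scaledMonic p with Vec.≡-dec _≟_ (fromList p) (replicate _ 0#)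
  ... | yes p≡0 = inj₁ (≋-trans (≡⇒≋ (sym (Vec.toList∘fromList p))) (≋-trans (≡⇒≋ (cong toList p≡0)) (toList-replicate-0 _)))
  ... | no p≢0 with scaledMonic (fromList p) p≢0
  ...   | a , a≢0 , e , _ , w , p≋aw = inj₂ (a , a≢0 , (e , w) , ≋-trans (≡⇒≋ (sym (Vec.toList∘fromList p))) p≋aw)

  scaledMonic-unique : ∀ {a b e e′} (w : Vec Carrier e) (w′ : Vec Carrier e′) → a ≢ 0# → b ≢ 0# →
                       a ·ₚ ⌜ w ⌝ ≋ b ·ₚ ⌜ w′ ⌝ → a ≡ b × (e , w) ≡ (e′ , w′)
  scaledMonic-unique {a} {b} [] [] _ _ aw≋bw′ = trans (sym (*-identityʳ a)) (trans (∷-injectiveˡ aw≋bw′) (*-identityʳ b)) , refl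
  scaledMonic-unique {b = b} [] (y ∷ w′) _ b≢0 aw≋bw′ =
    ⊥-elim (b≢0 (trans (sym (·ₚ⌜⌝-top b w′)) (sym (at (∷-injectiveʳ aw≋bw′) _))))
  scaledMonic-unique {a} (x ∷ w) [] a≢0 _ aw≋bw′ =
    ⊥-elim (a≢0 (trans (sym (·ₚ⌜⌝-top a w)) (at (∷-injectiveʳ aw≋bw′) _)))
  scaledMonic-unique (x ∷ w) (y ∷ w′) a≢0 b≢0 aw≋bw′ with scaledMonic-unique w w′ a≢0 b≢0 (∷-injectiveʳ aw≋bw′)
  ... | refl , refl = refl , cong (λ z → _ , z ∷ w) (*-cancelˡ x y a≢0 (∷-injectiveˡ aw≋bw′))

  monic-injective : ∀ f g → ⟦ f ⟧ ≋ ⟦ g ⟧ → f ≡ g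
  monic-injective (_ , u) (_ , v) u≋v =
    proj₂ (scaledMonic-unique u v 1≢0 1≢0 (≋-trans (·ₚ-identityˡ ⌜ u ⌝) (≋-trans u≋v (≋-sym (·ₚ-identityˡ ⌜ v ⌝)))))

  quotient-monic : ∀ P f s → ⟦ f ⟧ ≋ s *ₚ ⟦ P ⟧ → Σ Monic λ w → s ≋ ⟦ w ⟧ × f ≡ w *ᵐ P
  quotient-monic P f s f≋sP with zero⊎scaledMonic s
  ... | inj₁ s≋0 = ⊥-elim (⌜⌝≉[] (proj₂ f) (≋-trans f≋sP (*ₚ-zeroˡ ⟦ P ⟧ s≋0)))
  ... | inj₂ (a , a≢0 , w , s≋aw) with scaledMonic-unique (proj₂ (w *ᵐ P)) (proj₂ f) a≢0 1≢0 aw*P≋f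
    where
      aw*P≋f : a ·ₚ ⟦ w *ᵐ P ⟧ ≋ 1# ·ₚ ⟦ f ⟧
      aw*P≋f = ≋-sym (≋-trans (·ₚ-identityˡ ⟦ f ⟧) (≋-trans f≋sP (≋-trans (*ₚ-congˡ ⟦ P ⟧ s≋aw)
                 (≋-trans (·ₚ-*ₚ a ⟦ w ⟧ ⟦ P ⟧) (·ₚ-cong a (≋-sym (⟦*ᵐ⟧ w P)))))))
  ... | refl , wP≡f = w , ≋-trans s≋aw (·ₚ-identityˡ ⟦ w ⟧) , sym wP≡f

  *ᵐ-comm : ∀ f g → f *ᵐ g ≡ g *ᵐ f
  *ᵐ-comm f g = monic-injective (f *ᵐ g) (g *ᵐ f)
    (≋-trans (⟦*ᵐ⟧ f g) (≋-trans (*ₚ-comm ⟦ f ⟧ ⟦ g ⟧) (≋-sym (⟦*ᵐ⟧ g f))))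

  *ᵐ-assoc : ∀ f g h → (f *ᵐ g) *ᵐ h ≡ f *ᵐ (g *ᵐ h)
  *ᵐ-assoc f g h = monic-injective ((f *ᵐ g) *ᵐ h) (f *ᵐ (g *ᵐ h)) (begin
    ⟦ (f *ᵐ g) *ᵐ h ⟧          ≈⟨ ⟦*ᵐ⟧ (f *ᵐ g) h ⟩
    ⟦ f *ᵐ g ⟧ *ₚ ⟦ h ⟧        ≈⟨ *ₚ-congˡ ⟦ h ⟧ (⟦*ᵐ⟧ f g) ⟩
    (⟦ f ⟧ *ₚ ⟦ g ⟧) *ₚ ⟦ h ⟧  ≈⟨ *ₚ-assoc ⟦ f ⟧ ⟦ g ⟧ ⟦ h ⟧ ⟩
    ⟦ f ⟧ *ₚ (⟦ g ⟧ *ₚ ⟦ h ⟧)  ≈⟨ *ₚ-congʳ ⟦ f ⟧ (⟦*ᵐ⟧ g h) ⟨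
    ⟦ f ⟧ *ₚ ⟦ g *ᵐ h ⟧        ≈⟨ ⟦*ᵐ⟧ f (g *ᵐ h) ⟨
    ⟦ f *ᵐ (g *ᵐ h) ⟧          ∎)
    where open ≋-Reasoning

  *ᵐ-identityʳ : ∀ f → f *ᵐ 1ᵐ ≡ f
  *ᵐ-identityʳ f = *ᵐ-comm f 1ᵐ

  ^ᵐ-+ : ∀ f m n → f ^ᵐ (m ℕ.+ n) ≡ f ^ᵐ m *ᵐ f ^ᵐ n
  ^ᵐ-+ f zero n = refl
  ^ᵐ-+ f (suc m) n = trans (cong (f *ᵐ_) (^ᵐ-+ f m n)) (sym (*ᵐ-assoc f (f ^ᵐ m) (f ^ᵐ n)))

  *ᵐ-cancelˡ : ∀ f g h → f *ᵐ g ≡ f *ᵐ h → g ≡ h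
  *ᵐ-cancelˡ f g h fg≡fh = monic-injective g h (⌜⌝-*ₚ-cancelˡ (proj₂ f) ⟦ g ⟧ ⟦ h ⟧
    (≋-trans (≋-sym (⟦*ᵐ⟧ f g)) (≋-trans (≡⇒≋ (cong ⟦_⟧ fg≡fh)) (⟦*ᵐ⟧ f h))))

  ∣ₚ-^ᵐ-suc : ∀ f n → ⟦ f ⟧ ∣ₚ ⟦ f ^ᵐ suc n ⟧
  ∣ₚ-^ᵐ-suc f n = ⟦ f ^ᵐ n ⟧ , ≋-trans (⟦*ᵐ⟧ f (f ^ᵐ n)) (*ₚ-comm ⟦ f ⟧ ⟦ f ^ᵐ n ⟧)

module Units (F : FiniteField) where
  open import Data.Integer using (+_)
  open FiniteField F using (Carrier)
  open Poly F
  open PolynomialRing F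
  open Division F
  open Divisibility F
  open Monic F
  open IntegerCoefficientSolver polynomialRing using (solve; _:=_; _:+_; _:*_; _:-_; :-_; con)

  record InvertibleMod (f g : Pol) : Set where
    constructor invertible
    field
      h k : Pol
      g*h≋1+k*f : (g *ₚ h) ≋ 1ₚ +ₚ (k *ₚ f)

  invertible-respʳ : ∀ {f g g′} → g ≋ g′ → InvertibleMod f g → InvertibleMod f g′
  invertible-respʳ g≋g′ (invertible h k eq) = invertible h k (≋-trans (*ₚ-congˡ h (≋-sym g≋g′)) eq)

  invertible-respˡ : ∀ {f f′ g} → f ≋ f′ → InvertibleMod f g → InvertibleMod f′ g
  invertible-respˡ f≋f′ (invertible h k eq) = invertible h k (≋-trans eq (+ₚ-cong ≋-refl (*ₚ-congʳ k f≋f′)))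

  invertible-+multiple : ∀ {f g} t → InvertibleMod f g → InvertibleMod f (g +ₚ (t *ₚ f))
  invertible-+multiple {f} {g} t (invertible h k eq) = invertible h (k +ₚ (t *ₚ h)) (begin
    (g +ₚ (t *ₚ f)) *ₚ h
      ≈⟨ solve 4 (λ g t f h → (g :+ t :* f) :* h := g :* h :+ (t :* h) :* f) ≋-refl g t f h ⟩
    (g *ₚ h) +ₚ ((t *ₚ h) *ₚ f)
      ≈⟨ +ₚ-cong eq ≋-refl ⟩
    (1ₚ +ₚ (k *ₚ f)) +ₚ ((t *ₚ h) *ₚ f)
      ≈⟨ solve 4 (λ k f t h → (con (+ 1) :+ k :* f) :+ (t :* h) :* f := con (+ 1) :+ (k :+ t :* h) :* f) ≋-refl k f t h ⟩
    1ₚ +ₚ ((k +ₚ (t *ₚ h)) *ₚ f) ∎)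
    where open ≋-Reasoning

  invertible-+multiple⁻ : ∀ {f g} t → InvertibleMod f (g +ₚ (t *ₚ f)) → InvertibleMod f g
  invertible-+multiple⁻ {f} {g} t inv =
    invertible-respʳ (solve 3 (λ g t f → (g :+ t :* f) :+ (:- t) :* f := g) ≋-refl g t f) (invertible-+multiple (negₚ t) inv)

  invertible-∣ : ∀ {f f′ g} → f′ ∣ₚ f → InvertibleMod f g → InvertibleMod f′ g
  invertible-∣ {f′ = f′} (t , f≋tf′) (invertible h k eq) =
    invertible h (k *ₚ t) (≋-trans eq (+ₚ-cong ≋-refl (≋-trans (*ₚ-congʳ k f≋tf′) (≋-sym (*ₚ-assoc k t f′)))))

  invertible-*ₚ : ∀ {f g g′} → InvertibleMod f g → InvertibleMod f g′ → InvertibleMod f (g *ₚ g′)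
  invertible-*ₚ {f} {g} {g′} (invertible h k eq) (invertible h′ k′ eq′) =
    invertible (h *ₚ h′) (k +ₚ (k′ +ₚ (k *ₚ (k′ *ₚ f)))) (begin
    (g *ₚ g′) *ₚ (h *ₚ h′)
      ≈⟨ solve 4 (λ g g′ h h′ → (g :* g′) :* (h :* h′) := (g :* h) :* (g′ :* h′)) ≋-refl g g′ h h′ ⟩
    (g *ₚ h) *ₚ (g′ *ₚ h′)
      ≈⟨ *ₚ-cong eq eq′ ⟩
    (1ₚ +ₚ (k *ₚ f)) *ₚ (1ₚ +ₚ (k′ *ₚ f))
      ≈⟨ solve 3 (λ k k′ f → (con (+ 1) :+ k :* f) :* (con (+ 1) :+ k′ :* f)
                             := con (+ 1) :+ (k :+ (k′ :+ k :* (k′ :* f))) :* f) ≋-refl k k′ f ⟩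
    1ₚ +ₚ ((k +ₚ (k′ +ₚ (k *ₚ (k′ *ₚ f)))) *ₚ f) ∎)
    where open ≋-Reasoning

  -- If g h ≡ 1 mod f and g h′ ≡ 1 mod f′, then g (h + h′ - g h h′) = 1 - (1 - g h) (1 - g h′) ≡ 1 mod f f′.
  invertible-modulus-*ₚ : ∀ {f f′ g} → InvertibleMod f g → InvertibleMod f′ g → InvertibleMod (f *ₚ f′) g
  invertible-modulus-*ₚ {f} {f′} {g} (invertible h k eq) (invertible h′ k′ eq′) =
    invertible (h +ₚ (h′ +ₚ negₚ (g *ₚ (h *ₚ h′)))) (negₚ (k *ₚ k′)) (begin
      g *ₚ (h +ₚ (h′ +ₚ negₚ (g *ₚ (h *ₚ h′))))
        ≈⟨ solve 3 (λ g h h′ → g :* (h :+ (h′ :- g :* (h :* h′)))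
                               := con (+ 1) :- (con (+ 1) :- g :* h) :* (con (+ 1) :- g :* h′)) ≋-refl g h h′ ⟩
      1ₚ +ₚ negₚ ((1ₚ +ₚ negₚ (g *ₚ h)) *ₚ (1ₚ +ₚ negₚ (g *ₚ h′)))
        ≈⟨ +ₚ-cong (≋-refl {1ₚ})
             (negₚ-cong (*ₚ-cong (+ₚ-cong (≋-refl {1ₚ}) (negₚ-cong eq)) (+ₚ-cong (≋-refl {1ₚ}) (negₚ-cong eq′)))) ⟩
      1ₚ +ₚ negₚ ((1ₚ +ₚ negₚ (1ₚ +ₚ (k *ₚ f))) *ₚ (1ₚ +ₚ negₚ (1ₚ +ₚ (k′ *ₚ f′))))
        ≈⟨ solve 4 (λ k f k′ f′ → con (+ 1) :- (con (+ 1) :- (con (+ 1) :+ k :* f)) :* (con (+ 1) :- (con (+ 1) :+ k′ :* f′))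
                                  := con (+ 1) :+ (:- (k :* k′)) :* (f :* f′)) ≋-refl k f k′ f′ ⟩
      1ₚ +ₚ (negₚ (k *ₚ k′) *ₚ (f *ₚ f′)) ∎)
    where open ≋-Reasoning

  invertible-1 : ∀ {f} → InvertibleMod f 1ₚ
  invertible-1 = invertible 1ₚ [] (*ₚ-identityˡ 1ₚ)

  invertible-const : ∀ {f a} → a ≢ 0# → InvertibleMod f (a ∷ [])
  invertible-const {a = a} a≢0 = invertible (inv a a≢0 ∷ []) [] (∷-cong (trans (+-identityʳ _) (*-inverseʳ a a≢0)) ≋-refl)

  invertible-mod-1 : ∀ {g} → InvertibleMod 1ₚ g
  invertible-mod-1 {g} = invertible [] (negₚ 1ₚ) (≋-trans (*ₚ-zeroʳ g)
    (solve 0 (con (+ 0) := con (+ 1) :+ (:- con (+ 1)) :* con (+ 1)) ≋-refl))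

  bézout⇒invertible : ∀ {f g} u v → 1ₚ ≋ (u *ₚ g) +ₚ (v *ₚ f) → InvertibleMod f g
  bézout⇒invertible {f} {g} u v 1≋ug+vf = invertible u (negₚ v)
    (≋-trans (solve 4 (λ g u v f → g :* u := (u :* g :+ v :* f) :+ (:- v) :* f) ≋-refl g u v f) (+ₚ-cong (≋-sym 1≋ug+vf) ≋-refl))

  -- Otherwise 1 would be a multiple of ⌜ c ⌝, which has positive degree.
  invertible⇒∤ : ∀ {n} (c : Vec Carrier (suc n)) {g} → InvertibleMod ⌜ c ⌝ g → ¬ ⌜ c ⌝ ∣ₚ g
  invertible⇒∤ c {g} (invertible h k eq) (t , g≋tc) = 1≢0 (at 1≋0 0)
    where
      [th-k]*c≋1 : ((t *ₚ h) +ₚ negₚ k) *ₚ ⌜ c ⌝ ≋ 1ₚ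
      [th-k]*c≋1 = begin
        ((t *ₚ h) +ₚ negₚ k) *ₚ ⌜ c ⌝
          ≈⟨ solve 4 (λ t h k c → (t :* h :- k) :* c := (t :* c) :* h :- ((con (+ 1) :+ k :* c) :- con (+ 1))) ≋-refl t h k ⌜ c ⌝ ⟩
        ((t *ₚ ⌜ c ⌝) *ₚ h) +ₚ negₚ ((1ₚ +ₚ (k *ₚ ⌜ c ⌝)) +ₚ negₚ 1ₚ)
          ≈⟨ +ₚ-cong (*ₚ-congˡ h (≋-sym g≋tc)) (negₚ-cong (+ₚ-cong (≋-sym eq) ≋-refl)) ⟩
        (g *ₚ h) +ₚ negₚ ((g *ₚ h) +ₚ negₚ 1ₚ)
          ≈⟨ solve 1 (λ X → X :- (X :- con (+ 1)) := con (+ 1)) ≋-refl (g *ₚ h) ⟩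
        1ₚ ∎
        where open ≋-Reasoning
      1≋0 : 1ₚ ≋ []
      1≋0 = ≋-trans (≋-sym [th-k]*c≋1)
        (*ₚ-zeroˡ {(t *ₚ h) +ₚ negₚ k} ⌜ c ⌝ (degreeBelow-multiple c _ [th-k]*c≋1 λ { (suc i) _ → refl }))

  invertible-^ᵐ : ∀ {f} g n → InvertibleMod f ⟦ g ⟧ → InvertibleMod f ⟦ g ^ᵐ n ⟧
  invertible-^ᵐ g zero _ = invertible-1
  invertible-^ᵐ g (suc n) inv = invertible-respʳ (≋-sym (⟦*ᵐ⟧ g (g ^ᵐ n))) (invertible-*ₚ inv (invertible-^ᵐ g n inv))

  invertible-mod-^ᵐ : ∀ P {g} n → InvertibleMod ⟦ P ⟧ g → InvertibleMod ⟦ P ^ᵐ n ⟧ g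
  invertible-mod-^ᵐ P zero _ = invertible-mod-1
  invertible-mod-^ᵐ P (suc n) inv =
    invertible-respˡ (≋-sym (⟦*ᵐ⟧ P (P ^ᵐ n))) (invertible-modulus-*ₚ inv (invertible-mod-^ᵐ P n inv))

  invertible-rem : ∀ {n} (c : Vec Carrier n) {p} → InvertibleMod ⌜ c ⌝ p → InvertibleMod ⌜ c ⌝ (toList (rem c p))
  invertible-rem c {p} inv = invertible-+multiple⁻ (quot c p)
    (invertible-respʳ (≋-trans (divMod-≋ c p) (+ₚ-comm (quot c p *ₚ ⌜ c ⌝) (toList (rem c p)))) inv)

  invertible-rem⁻ : ∀ {n} (c : Vec Carrier n) {p} → InvertibleMod ⌜ c ⌝ (toList (rem c p)) → InvertibleMod ⌜ c ⌝ p
  invertible-rem⁻ c {p} inv = invertible-respʳ (≋-trans (+ₚ-comm (toList (rem c p)) (quot c p *ₚ ⌜ c ⌝)) (≋-sym (divMod-≋ c p)))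
    (invertible-+multiple (quot c p) inv)

  coprime-∣ₚ : ∀ {f g D} → InvertibleMod f g → f ∣ₚ D → g ∣ₚ D → (f *ₚ g) ∣ₚ D
  coprime-∣ₚ {f} {g} {D} (invertible a k ga≋1+kf) (D₁ , D≋D₁f) (D₂ , D≋D₂g) = (D₁ *ₚ a) +ₚ negₚ (D₂ *ₚ k) , (begin
    D
      ≈⟨ solve 3 (λ D k f → D := D :* ((con (+ 1) :+ k :* f) :- k :* f)) ≋-refl D k f ⟩
    D *ₚ ((1ₚ +ₚ (k *ₚ f)) +ₚ negₚ (k *ₚ f))
      ≈⟨ *ₚ-congʳ D (+ₚ-cong ga≋1+kf ≋-refl) ⟨
    D *ₚ ((g *ₚ a) +ₚ negₚ (k *ₚ f))
      ≈⟨ solve 5 (λ D g a k f → D :* (g :* a :- k :* f) := (D :* g) :* a :- (D :* f) :* k) ≋-refl D g a k f ⟩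
    ((D *ₚ g) *ₚ a) +ₚ negₚ ((D *ₚ f) *ₚ k)
      ≈⟨ +ₚ-cong (*ₚ-congˡ a (*ₚ-congˡ g D≋D₁f)) (negₚ-cong (*ₚ-congˡ k (*ₚ-congˡ f D≋D₂g))) ⟩
    (((D₁ *ₚ f) *ₚ g) *ₚ a) +ₚ negₚ (((D₂ *ₚ g) *ₚ f) *ₚ k)
      ≈⟨ solve 6 (λ D₁ D₂ f g a k → ((D₁ :* f) :* g) :* a :- ((D₂ :* g) :* f) :* k := (D₁ :* a :- D₂ :* k) :* (f :* g))
                 ≋-refl D₁ D₂ f g a k ⟩
    ((D₁ *ₚ a) +ₚ negₚ (D₂ *ₚ k)) *ₚ (f *ₚ g) ∎)
    where open ≋-Reasoning

module Primes (F : FiniteField) where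
  open import Data.Nat using (_≤?_)
  open import Relation.Nullary.Decidable using (_×-dec_)
  open FiniteField F using (Carrier; enum)
  open Poly F
  open PolynomialRing F
  open Division F
  open Divisibility F
  open Monic F
  open Units F
  open IntegerCoefficientSolver polynomialRing using (solve; _:=_; _:+_; _:*_; _:-_; :-_; con)

  record Bézout (a b : Pol) : Set where
    constructor bézout
    field
      gcd : Monic
      gcd∣a : ⟦ gcd ⟧ ∣ₚ a
      gcd∣b : ⟦ gcd ⟧ ∣ₚ b
      u v : Pol
      identity : ⟦ gcd ⟧ ≋ (u *ₚ b) +ₚ (v *ₚ a)

  euclid : ∀ {n} (c : Vec Carrier n) r → Bézout ⌜ c ⌝ r
  euclid {n} c r = go c r (<-wellFounded n)
    where
      go : ∀ {n} (c : Vec Carrier n) r → Acc _<_ n → Bézout ⌜ c ⌝ r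
      go {n} c r (acc smaller) with Vec.≡-dec _≟_ (rem c r) (replicate n 0#)
      ... | yes r≡0 = bézout (n , c) ∣ₚ-refl (rem≡0⇒∣ₚ c r≡0) [] 1ₚ (≋-sym (*ₚ-identityˡ ⌜ c ⌝))
      ... | no r≢0 with scaledMonic (rem c r) r≢0
      ...   | a , a≢0 , e , e<n , w , rem≋aw with go w ⌜ c ⌝ (smaller e<n)
      ...     | bézout G G∣w G∣c u v G≋uc+vw = bézout G G∣c G∣r (v *ₚ a⁻¹) (u +ₚ negₚ (v *ₚ (a⁻¹ *ₚ Q))) G≋
        where
          Q = quot c r
          a⁻¹ = inv a a≢0 ∷ []
          w≋a⁻¹[r-Qc] : ⌜ w ⌝ ≋ a⁻¹ *ₚ (r +ₚ negₚ (Q *ₚ ⌜ c ⌝))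
          w≋a⁻¹[r-Qc] = begin
            ⌜ w ⌝
              ≈⟨ ·ₚ-identityˡ ⌜ w ⌝ ⟨
            1# ·ₚ ⌜ w ⌝
              ≡⟨ cong (_·ₚ ⌜ w ⌝) (trans (sym (*-inverseʳ a a≢0)) (*-comm a _)) ⟩
            (inv a a≢0 * a) ·ₚ ⌜ w ⌝
              ≈⟨ ·ₚ-assoc (inv a a≢0) a ⌜ w ⌝ ⟨
            inv a a≢0 ·ₚ a ·ₚ ⌜ w ⌝
              ≈⟨ [a]*ₚ (inv a a≢0) (a ·ₚ ⌜ w ⌝) ⟨
            a⁻¹ *ₚ (a ·ₚ ⌜ w ⌝)
              ≈⟨ *ₚ-congʳ a⁻¹ rem≋aw ⟨
            a⁻¹ *ₚ toList (rem c r)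
              ≈⟨ *ₚ-congʳ a⁻¹ (solve 3 (λ R Q c → R := (Q :* c :+ R) :- Q :* c) ≋-refl (toList (rem c r)) Q ⌜ c ⌝) ⟩
            a⁻¹ *ₚ (((Q *ₚ ⌜ c ⌝) +ₚ toList (rem c r)) +ₚ negₚ (Q *ₚ ⌜ c ⌝))
              ≈⟨ *ₚ-congʳ a⁻¹ (+ₚ-cong (≋-sym (divMod-≋ c r)) ≋-refl) ⟩
            a⁻¹ *ₚ (r +ₚ negₚ (Q *ₚ ⌜ c ⌝)) ∎
            where open ≋-Reasoning
          G∣r : ⟦ G ⟧ ∣ₚ r
          G∣r = ∣ₚ-respʳ (≋-sym (≋-trans (divMod-≋ c r) (+ₚ-cong ≋-refl (≋-trans rem≋aw (≋-sym ([a]*ₚ a ⌜ w ⌝))))))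
                         (∣ₚ-+ₚ (∣ₚ-*ˡ Q G∣c) (∣ₚ-*ˡ (a ∷ []) G∣w))
          G≋ : ⟦ G ⟧ ≋ ((v *ₚ a⁻¹) *ₚ r) +ₚ ((u +ₚ negₚ (v *ₚ (a⁻¹ *ₚ Q))) *ₚ ⌜ c ⌝)
          G≋ = ≋-trans G≋uc+vw (≋-trans (+ₚ-cong ≋-refl (*ₚ-congʳ v w≋a⁻¹[r-Qc]))
            (solve 6 (λ u v a⁻¹ r Q c → u :* c :+ v :* (a⁻¹ :* (r :- Q :* c)) := (v :* a⁻¹) :* r :+ (u :- v :* (a⁻¹ :* Q)) :* c)
                     ≋-refl u v a⁻¹ r Q ⌜ c ⌝))

  Prime : Monic → Set
  Prime P = 1 ≤ deg P × (∀ g → ¬ ⟦ P ⟧ ∣ₚ g → InvertibleMod ⟦ P ⟧ g)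

  HasProperDivisor : Monic → Set
  HasProperDivisor f = ∃ λ j → j < deg f × (1 ≤ j × Σ (Vec Carrier j) λ w → ⌜ w ⌝ ∣ₚ ⟦ f ⟧)

  hasProperDivisor? : ∀ f → Dec (HasProperDivisor f)
  hasProperDivisor? f = ℕ.anyUpTo? (λ j → (1 ≤? j) ×-dec HasCard-∃? (HasCard-Vec enum j) (_∣ₚ? ⟦ f ⟧)) (deg f)

  -- The gcd of P and g divides P, which has no proper divisor, and it is not P since P ∤ g; so it is 1.
  ¬properDivisor⇒prime : ∀ {P} → 1 ≤ deg P → ¬ HasProperDivisor P → Prime P
  ¬properDivisor⇒prime {P} 1≤P no-proper = 1≤P , invertible-if-∤
    where
      invertible-if-∤ : ∀ g → ¬ ⟦ P ⟧ ∣ₚ g → InvertibleMod ⟦ P ⟧ g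
      invertible-if-∤ g P∤g with euclid (proj₂ P) g
      ... | bézout G (t , P≋tG) G∣g u v G≋ug+vP with quotient-monic G P t P≋tG
      ...   | (zero , []) , _ , refl = ⊥-elim (P∤g G∣g)
      ...   | (suc k , w) , _ , P≡wG = gcd≡1 G (t , P≋tG) P≡wG G≋ug+vP
        where
          gcd≡1 : ∀ G → ⟦ G ⟧ ∣ₚ ⟦ P ⟧ → P ≡ (suc k , w) *ᵐ G → ⟦ G ⟧ ≋ (u *ₚ g) +ₚ (v *ₚ ⟦ P ⟧) →
                  InvertibleMod ⟦ P ⟧ g
          gcd≡1 (zero , []) _ _ 1≋ug+vP = bézout⇒invertible u v 1≋ug+vP
          gcd≡1 (suc j , x) G∣P refl _ = ⊥-elim (no-proper (suc j , s≤s (ℕ.m≤n+m (suc j) k) , s≤s z≤n , x , G∣P))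

  prime-divisor : ∀ f → 1 ≤ deg f → Σ Monic λ P → Prime P × ⟦ P ⟧ ∣ₚ ⟦ f ⟧
  prime-divisor f = go f (<-wellFounded (deg f))
    where
      go : ∀ f → Acc _<_ (deg f) → 1 ≤ deg f → Σ Monic λ P → Prime P × ⟦ P ⟧ ∣ₚ ⟦ f ⟧
      go f (acc smaller) 1≤f with hasProperDivisor? f
      ... | no none = f , ¬properDivisor⇒prime 1≤f none , ∣ₚ-refl
      ... | yes (j , j<f , 1≤j , w , w∣f) with go (j , w) (smaller j<f) 1≤j
      ...   | P , P-prime , P∣w = P , P-prime , ∣ₚ-trans P∣w w∣f

  prime-power-split : ∀ P f → Prime P → ⟦ P ⟧ ∣ₚ ⟦ f ⟧ →
                      Σ ℕ λ e → Σ Monic λ g → f ≡ P ^ᵐ suc e *ᵐ g × ¬ ⟦ P ⟧ ∣ₚ ⟦ g ⟧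
  prime-power-split P f (1≤P , _) = go f (<-wellFounded (deg f))
    where
      go : ∀ f → Acc _<_ (deg f) → ⟦ P ⟧ ∣ₚ ⟦ f ⟧ →
           Σ ℕ λ e → Σ Monic λ g → f ≡ P ^ᵐ suc e *ᵐ g × ¬ ⟦ P ⟧ ∣ₚ ⟦ g ⟧
      go f (acc smaller) (s , f≋sP) with quotient-monic P f s f≋sP
      ... | w , _ , refl with proj₂ P ∣ₚ? ⟦ w ⟧
      ...   | no P∤w = 0 , w , trans (*ᵐ-comm w P) (cong (_*ᵐ w) (sym (*ᵐ-identityʳ P))) , P∤w
      ...   | yes P∣w with go w (smaller (ℕ.m<m+n (deg w) 1≤P)) P∣w
      ...     | e , g , refl , P∤g = suc e , g , trans (*ᵐ-comm (P ^ᵐ suc e *ᵐ g) P) (sym (*ᵐ-assoc P (P ^ᵐ suc e) g)) , P∤g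

module Totient (F : FiniteField) where
  open import Data.Integer using (+_)
  open FiniteField F using (Carrier; enum; size)
  open Poly F
  open PolynomialRing F
  open Division F
  open Divisibility F
  open Monic F
  open Units F
  open Primes F
  open IntegerCoefficientSolver polynomialRing using (solve; _:=_; _:+_; _:*_; _:-_; :-_; con)

  UnitCount : Monic → ℕ → Set
  UnitCount f n = HasCard {Vec Carrier (deg f)} (λ r → InvertibleMod ⟦ f ⟧ (toList r)) n

  -- Modulo ⌜ c ⌝ ⌜ c′ ⌝ the residues divisible by ⌜ c ⌝ are the ⌜ c ⌝ s with deg s < D.
  multiples-count : ∀ {d D} (c : Vec Carrier d) (c′ : Vec Carrier D) →
                    HasCard {Vec Carrier (d ℕ.+ D)} (λ r → ⌜ c ⌝ ∣ₚ toList r) (size ^ D)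
  multiples-count {d} {D} c c′ = HasCard-image times-c times-c-injective multiple⇔image (HasCard-Vec enum D)
    where
      cc′ = proj₂ ((d , c) *ᵐ (D , c′))
      times-c : Vec Carrier D → Vec Carrier (d ℕ.+ D)
      times-c s = coeffs (d ℕ.+ D) (⌜ c ⌝ *ₚ toList s)
      toList-times-c : ∀ s → toList (times-c s) ≋ ⌜ c ⌝ *ₚ toList s
      toList-times-c s = toList-coeffs _ _ (degreeBelow-*ₚ ⌜ c ⌝ (toList s) (⌜⌝-degreeBelow c) (toList-degreeBelow s))
      times-c-injective : ∀ {s s′} → ⊤ → ⊤ → times-c s ≡ times-c s′ → s ≡ s′
      times-c-injective {s} {s′} _ _ eq = toList-injective s s′ (⌜⌝-*ₚ-cancelˡ c (toList s) (toList s′)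
        (≋-trans (≋-sym (toList-times-c s)) (≋-trans (≡⇒≋ (cong toList eq)) (toList-times-c s′))))
      multiple⇔image : ∀ r → ⌜ c ⌝ ∣ₚ toList r ⇔ Σ (Vec Carrier D) λ s → ⊤ × times-c s ≡ r
      multiple⇔image r = mk⇔ to from
        where
          to : ⌜ c ⌝ ∣ₚ toList r → Σ (Vec Carrier D) λ s → ⊤ × times-c s ≡ r
          to (k , r≋kc) = s , tt , sym (trans (sym (rem-toList cc′ r)) (rem-unique cc′ Q (times-c s) r≋))
            where
              Q = quot c′ k
              s = rem c′ k
              r≋ : toList r ≋ (Q *ₚ ⌜ cc′ ⌝) +ₚ toList (times-c s)
              r≋ = ≋-trans r≋kc (≋-trans (*ₚ-congˡ ⌜ c ⌝ (divMod-≋ c′ k))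
                     (≋-trans (solve 4 (λ Q c′ s c → (Q :* c′ :+ s) :* c := Q :* (c :* c′) :+ c :* s) ≋-refl Q ⌜ c′ ⌝ (toList s) ⌜ c ⌝)
                     (+ₚ-cong (*ₚ-congʳ Q (≋-sym (⟦*ᵐ⟧ (d , c) (D , c′)))) (≋-sym (toList-times-c s)))))
          from : (Σ (Vec Carrier D) λ s → ⊤ × times-c s ≡ r) → ⌜ c ⌝ ∣ₚ toList r
          from (s , _ , refl) = toList s , ≋-trans (toList-times-c s) (*ₚ-comm ⌜ c ⌝ (toList s))

  -- A residue modulo P ^ (e + 1) is a unit iff P does not divide it.
  unitCount-prime-power : ∀ P → Prime P → ∀ e → UnitCount (P ^ᵐ suc e) (size ^ deg (P ^ᵐ suc e) ∸ size ^ deg (P ^ᵐ e))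
  unitCount-prime-power (zero , _) (() , _) e
  unitCount-prime-power P@(suc _ , c) (_ , prime) e =
    HasCard-⇔ ∤⇔invertible (HasCard-∁ (λ r → c ∣ₚ? toList r) (HasCard-Vec enum _) (multiples-count c (proj₂ (P ^ᵐ e))))
    where
      P∣Pᵉ⁺¹ : ⟦ P ⟧ ∣ₚ ⟦ P ^ᵐ suc e ⟧
      P∣Pᵉ⁺¹ = ∣ₚ-^ᵐ-suc P e
      ∤⇔invertible : ∀ r → (¬ ⌜ c ⌝ ∣ₚ toList r) ⇔ InvertibleMod ⟦ P ^ᵐ suc e ⟧ (toList r)
      ∤⇔invertible r = mk⇔ (λ P∤r → invertible-mod-^ᵐ P (suc e) (prime (toList r) P∤r))
                           (invertible⇒∤ c ∘ invertible-∣ P∣Pᵉ⁺¹)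

  module CRT (g h : Monic) (g⊥h : InvertibleMod ⟦ g ⟧ ⟦ h ⟧) where
    open InvertibleMod g⊥h renaming (h to a; g*h≋1+k*f to ha≋1+kg)

    private
      cg = proj₂ g
      ch = proj₂ h
      cgh = proj₂ (g *ᵐ h)

      -- r + (s - r)(1 - h a), where h a ≡ 1 mod g: it is r mod g and s mod h.
      lift : Pol → Pol → Pol
      lift r s = r +ₚ ((s +ₚ negₚ r) *ₚ (1ₚ +ₚ negₚ (⟦ h ⟧ *ₚ a)))

      lift≡r : ∀ r s → lift r s ≋ (((r +ₚ negₚ s) *ₚ k) *ₚ ⟦ g ⟧) +ₚ r
      lift≡r r s = ≋-trans (+ₚ-cong (≋-refl {r}) (*ₚ-congʳ (s +ₚ negₚ r) (+ₚ-cong (≋-refl {1ₚ}) (negₚ-cong ha≋1+kg))))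
        (solve 4 (λ r s k G → r :+ (s :- r) :* (con (+ 1) :- (con (+ 1) :+ k :* G)) := ((r :- s) :* k) :* G :+ r) ≋-refl r s k ⟦ g ⟧)

      lift≡s : ∀ r s → lift r s ≋ (((r +ₚ negₚ s) *ₚ a) *ₚ ⟦ h ⟧) +ₚ s
      lift≡s r s = solve 4 (λ r s a H → r :+ (s :- r) :* (con (+ 1) :- H :* a) := ((r :- s) :* a) :* H :+ s) ≋-refl r s a ⟦ h ⟧

      g∣gh : ⟦ g ⟧ ∣ₚ ⟦ g *ᵐ h ⟧
      g∣gh = ⟦ h ⟧ , ≋-trans (⟦*ᵐ⟧ g h) (*ₚ-comm ⟦ g ⟧ ⟦ h ⟧)

      h∣gh : ⟦ h ⟧ ∣ₚ ⟦ g *ᵐ h ⟧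
      h∣gh = ⟦ g ⟧ , ⟦*ᵐ⟧ g h

    crt : Vec Carrier (deg g) × Vec Carrier (deg h) → Vec Carrier (deg (g *ᵐ h))
    crt (r , s) = rem cgh (lift (toList r) (toList s))

    rem-g-crt : ∀ r s → rem cg (toList (crt (r , s))) ≡ r
    rem-g-crt r s = trans (rem-rem cg cgh g∣gh _) (rem-unique cg ((toList r +ₚ negₚ (toList s)) *ₚ k) r (lift≡r (toList r) (toList s)))

    rem-h-crt : ∀ r s → rem ch (toList (crt (r , s))) ≡ s
    rem-h-crt r s = trans (rem-rem ch cgh h∣gh _) (rem-unique ch ((toList r +ₚ negₚ (toList s)) *ₚ a) s (lift≡s (toList r) (toList s)))

    crt-injective : ∀ {x y} → crt x ≡ crt y → x ≡ y
    crt-injective {r , s} {r′ , s′} eq =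
      cong₂ _,_ (trans (sym (rem-g-crt r s)) (trans (cong (rem cg ∘ toList) eq) (rem-g-crt r′ s′)))
                (trans (sym (rem-h-crt r s)) (trans (cong (rem ch ∘ toList) eq) (rem-h-crt r′ s′)))

    crt-rem : ∀ (t : Vec Carrier (deg (g *ᵐ h))) → crt (rem cg (toList t) , rem ch (toList t)) ≡ t
    crt-rem t = trans (sym (rem-toList cgh _)) (trans (∣ₚ⇒rem≡ cgh gh∣crt-t) (rem-toList cgh t))
      where
        r = rem cg (toList t)
        s = rem ch (toList t)
        gh∣crt-t : ⟦ g *ᵐ h ⟧ ∣ₚ toList (crt (r , s)) +ₚ negₚ (toList t)
        gh∣crt-t = ∣ₚ-respˡ (≋-sym (⟦*ᵐ⟧ g h))
          (coprime-∣ₚ g⊥h (rem≡⇒∣ₚ cg (rem-g-crt r s)) (rem≡⇒∣ₚ ch (rem-h-crt r s)))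

    invertible-crt⁻ : ∀ (t : Vec Carrier (deg (g *ᵐ h))) → InvertibleMod ⟦ g *ᵐ h ⟧ (toList t) →
                      InvertibleMod ⟦ g ⟧ (toList (rem cg (toList t))) × InvertibleMod ⟦ h ⟧ (toList (rem ch (toList t)))
    invertible-crt⁻ t inv = invertible-rem cg (invertible-∣ g∣gh inv) , invertible-rem ch (invertible-∣ h∣gh inv)

    invertible-crt : ∀ r s → InvertibleMod ⟦ g ⟧ (toList r) → InvertibleMod ⟦ h ⟧ (toList s) →
                     InvertibleMod ⟦ g *ᵐ h ⟧ (toList (crt (r , s)))
    invertible-crt r s inv-r inv-s = invertible-respˡ (≋-sym (⟦*ᵐ⟧ g h)) (invertible-modulus-*ₚ
      (invertible-rem⁻ cg (subst (InvertibleMod ⟦ g ⟧ ∘ toList) (sym (rem-g-crt r s)) inv-r))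
      (invertible-rem⁻ ch (subst (InvertibleMod ⟦ h ⟧ ∘ toList) (sym (rem-h-crt r s)) inv-s)))

  unitCount-* : ∀ g h → InvertibleMod ⟦ g ⟧ ⟦ h ⟧ → ∀ {m n} → UnitCount g m → UnitCount h n → UnitCount (g *ᵐ h) (m ℕ.* n)
  unitCount-* g h g⊥h count-g count-h = HasCard-image crt (λ _ _ → crt-injective) units⇔image (HasCard-× count-g count-h)
    where
      open CRT g h g⊥h
      units⇔image : ∀ t → InvertibleMod ⟦ g *ᵐ h ⟧ (toList t) ⇔
                    Σ (Vec Carrier (deg g) × Vec Carrier (deg h)) λ (r , s) →
                      (InvertibleMod ⟦ g ⟧ (toList r) × InvertibleMod ⟦ h ⟧ (toList s)) × crt (r , s) ≡ t
      units⇔image t = mk⇔ (λ inv → _ , invertible-crt⁻ t inv , crt-rem t)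
                          (λ { ((r , s) , (inv-r , inv-s) , refl) → invertible-crt r s inv-r inv-s })

module LinearFactors (F : FiniteField) where
  open FiniteField F using (Carrier)
  open Poly F
  open PolynomialRing F
  open Division F
  open Divisibility F
  open Monic F
  open Units F
  open Primes F
  open RingProperties (CommutativeRing.ring coefficientRing) using (-‿injective; -‿involutive)

  x-_ : Carrier → Monic
  x- a = 1 , - a ∷ []

  x-‿injective : ∀ {a b} → x- a ≡ x- b → a ≡ b
  x-‿injective eq = -‿injective (cong (λ f → coeff ⟦ f ⟧ 0) eq)

  x-‿prime : ∀ a → Prime (x- a)
  x-‿prime a = s≤s z≤n , invertible-if-∤
    where
      invertible-if-∤ : ∀ g → ¬ ⟦ x- a ⟧ ∣ₚ g → InvertibleMod ⟦ x- a ⟧ g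
      invertible-if-∤ g x-a∤g with rem (- a ∷ []) g in rem≡
      ... | c₀ ∷ [] with c₀ ≟ 0#
      ...   | yes refl = ⊥-elim (x-a∤g (rem≡0⇒∣ₚ (- a ∷ []) rem≡))
      ...   | no c₀≢0 = invertible-rem⁻ (- a ∷ []) (subst (InvertibleMod ⟦ x- a ⟧ ∘ toList) (sym rem≡) (invertible-const c₀≢0))

  x-‿∣⇒≡ : ∀ {a b} → ⟦ x- a ⟧ ∣ₚ ⟦ x- b ⟧ → a ≡ b
  x-‿∣⇒≡ {a} {b} (s , b≋sa) with quotient-monic (x- a) (x- b) s b≋sa
  ... | (zero , []) , _ , x-b≡x-a = sym (x-‿injective x-b≡x-a)
  ... | (suc k , w) , _ , x-b≡wx-a with () ← ℕ.suc-injective (trans (cong deg x-b≡wx-a) (ℕ.+-comm (suc k) 1))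

  x-‿coprime : ∀ {a b} → a ≢ b → InvertibleMod ⟦ x- a ⟧ ⟦ x- b ⟧
  x-‿coprime {a} {b} a≢b = proj₂ (x-‿prime a) ⟦ x- b ⟧ (a≢b ∘ x-‿∣⇒≡)

  x-^-coprime : ∀ {a b} → a ≢ b → ∀ i j → InvertibleMod ⟦ (x- a) ^ᵐ i ⟧ ⟦ (x- b) ^ᵐ j ⟧
  x-^-coprime {a} {b} a≢b i j = invertible-mod-^ᵐ (x- a) i (invertible-^ᵐ (x- b) j (x-‿coprime a≢b))

  linear≡x- : ∀ c₀ → (1 , c₀ ∷ []) ≡ x- (- c₀)
  linear≡x- c₀ = cong (λ c → 1 , c ∷ []) (sym (-‿involutive c₀))

  twoRoots : Carrier → Carrier → ℕ → ℕ → Monic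
  twoRoots a b i j = (x- a) ^ᵐ suc i *ᵐ (x- b) ^ᵐ suc j

  twoRoots-comm : ∀ a b i j → twoRoots a b i j ≡ twoRoots b a j i
  twoRoots-comm a b i j = *ᵐ-comm ((x- a) ^ᵐ suc i) ((x- b) ^ᵐ suc j)

  x-∣twoRoots : ∀ a b i j → ⟦ x- a ⟧ ∣ₚ ⟦ twoRoots a b i j ⟧
  x-∣twoRoots a b i j =
    ∣ₚ-trans (∣ₚ-^ᵐ-suc (x- a) i)
      (∣ₚ-respʳ (≋-sym (⟦*ᵐ⟧ ((x- a) ^ᵐ suc i) ((x- b) ^ᵐ suc j))) (∣ₚ-*ʳ ⟦ (x- b) ^ᵐ suc j ⟧ ∣ₚ-refl))

  roots-of-twoRoots : ∀ {c} a b i j → ⟦ x- c ⟧ ∣ₚ ⟦ twoRoots a b i j ⟧ → c ≡ a ⊎ c ≡ b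
  roots-of-twoRoots {c} a b i j x-c∣f with c ≟ a | c ≟ b
  ... | yes c≡a | _ = inj₁ c≡a
  ... | no _ | yes c≡b = inj₂ c≡b
  ... | no c≢a | no c≢b = ⊥-elim (invertible⇒∤ (- c ∷ []) x-c⊥f x-c∣f)
    where
      x-c⊥f : InvertibleMod ⟦ x- c ⟧ ⟦ twoRoots a b i j ⟧
      x-c⊥f = invertible-respʳ (≋-sym (⟦*ᵐ⟧ ((x- a) ^ᵐ suc i) ((x- b) ^ᵐ suc j)))
        (invertible-*ₚ (invertible-^ᵐ (x- a) (suc i) (x-‿coprime c≢a)) (invertible-^ᵐ (x- b) (suc j) (x-‿coprime c≢b)))

  private
    twoRoots-exponent-< : ∀ {a b} → a ≢ b → ∀ i j k j′ → twoRoots a b i j ≢ twoRoots a b (i ℕ.+ suc k) j′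
    twoRoots-exponent-< {a} {b} a≢b i j k j′ eq =
      invertible⇒∤ (- a ∷ []) (invertible-^ᵐ (x- b) (suc j) (x-‿coprime a≢b))
        (∣ₚ-respʳ (≡⇒≋ (cong ⟦_⟧ (sym B≡))) x-a∣A′B′)
      where
        A = (x- a) ^ᵐ suc i
        A′ = (x- a) ^ᵐ suc k
        B′ = (x- b) ^ᵐ suc j′
        B≡ : (x- b) ^ᵐ suc j ≡ A′ *ᵐ B′
        B≡ = *ᵐ-cancelˡ A _ _ (trans eq (trans (cong (_*ᵐ B′) (^ᵐ-+ (x- a) (suc i) (suc k))) (*ᵐ-assoc A A′ B′)))
        x-a∣A′B′ : ⟦ x- a ⟧ ∣ₚ ⟦ A′ *ᵐ B′ ⟧
        x-a∣A′B′ = ∣ₚ-trans (∣ₚ-^ᵐ-suc (x- a) k) (∣ₚ-respʳ (≋-sym (⟦*ᵐ⟧ A′ B′)) (∣ₚ-*ʳ ⟦ B′ ⟧ ∣ₚ-refl))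

  twoRoots-exponent-injective : ∀ {a b} → a ≢ b → ∀ {i j i′ j′} → twoRoots a b i j ≡ twoRoots a b i′ j′ → i ≡ i′
  twoRoots-exponent-injective {a} {b} a≢b {i} {j} {i′} {j′} eq with ℕ.<-cmp i i′
  ... | tri≈ _ i≡i′ _ = i≡i′
  ... | tri< i<i′ _ _ = ⊥-elim (twoRoots-exponent-< a≢b i j (i′ ℕ.∸ suc i) j′
                          (subst (λ i′ → twoRoots a b i j ≡ twoRoots a b i′ j′) (m<n⇒n≡m+1+[n∸1+m] i<i′) eq))
  ... | tri> _ _ i′<i = ⊥-elim (twoRoots-exponent-< a≢b i′ j′ (i ℕ.∸ suc i′) j
                          (subst (λ i → twoRoots a b i′ j′ ≡ twoRoots a b i j) (m<n⇒n≡m+1+[n∸1+m] i′<i) (sym eq)))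

module Classification (F : FiniteField) (p : ℕ) (size≡1+p : FiniteField.size F ≡ suc p) (2≤p : 2 ≤ p) where
  open import Data.Nat using (_+_; _*_)
  open FiniteField F using (Carrier; size)
  open Poly F
  open PolynomialRing F using (-_; _≋_)
  open Division F
  open Divisibility F
  open Monic F
  open Units F
  open Primes F
  open Totient F
  open LinearFactors F

  q : ℕ
  q = suc p

  private
    1≤p : 1 ≤ p
    1≤p = ℕ.≤-trans (s≤s z≤n) 2≤p

    2≤q : 2 ≤ q
    2≤q = ℕ.m≤n⇒m≤1+n 2≤p

    instance
      p-nonZero : NonZero p
      p-nonZero = ℕ.>-nonZero 1≤p

    p⊥q : Coprime p q
    p⊥q = subst (λ m → Coprime m q) ([1+p]^1∸1≡p p) (coprime-^∸1 0)

  unitCount-prime-power′ : ∀ P → Prime P → ∀ e → UnitCount (P ^ᵐ suc e) (q ^ deg (P ^ᵐ e) * (q ^ deg P ∸ 1))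
  unitCount-prime-power′ P P-prime e = subst (UnitCount (P ^ᵐ suc e))
    (trans (cong (λ q → q ^ deg (P ^ᵐ suc e) ∸ q ^ deg (P ^ᵐ e)) size≡1+p) (^∸^≡^*[^∸1] q (deg P) (deg (P ^ᵐ e))))
    (unitCount-prime-power P P-prime e)

  deg-x-^ : ∀ a i → deg ((x- a) ^ᵐ i) ≡ i
  deg-x-^ a i = trans (deg-^ᵐ (x- a) i) (ℕ.*-identityʳ i)

  unitCount-x-^ : ∀ a i → UnitCount ((x- a) ^ᵐ suc i) (q ^ i * p)
  unitCount-x-^ a i = subst (UnitCount ((x- a) ^ᵐ suc i)) (cong₂ (λ d m → q ^ d * m) (deg-x-^ a i) ([1+p]^1∸1≡p p))
    (unitCount-prime-power′ (x- a) (x-‿prime a) i)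

  unitCount-twoRoots : ∀ {a b} → a ≢ b → ∀ i j → UnitCount (twoRoots a b i j) (q ^ (i + j) * (p * p))
  unitCount-twoRoots {a} {b} a≢b i j = subst (UnitCount (twoRoots a b i j)) (^*-*-^* q i p j p)
    (unitCount-* ((x- a) ^ᵐ suc i) ((x- b) ^ᵐ suc j) (x-^-coprime a≢b (suc i) (suc j)) (unitCount-x-^ a i) (unitCount-x-^ b j))

  data Shape (f : Monic) (n : ℕ) : Set where
    one-root  : ∀ a i → f ≡ (x- a) ^ᵐ suc i → n ≡ q ^ i * p → Shape f n
    two-roots : ∀ a b i j → a ≢ b → f ≡ twoRoots a b i j → n ≡ q ^ (i + j) * (p * p) → Shape f n
    large     : ∀ s m → Coprime m q → p * p < m → n ≡ q ^ s * m → Shape f n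

  private
    linear-power-count : ∀ c₀ e → q ^ deg ((1 , c₀ ∷ []) ^ᵐ e) * (q ^ 1 ∸ 1) ≡ q ^ e * p
    linear-power-count c₀ e = cong₂ (λ d m → q ^ d * m) (trans (deg-^ᵐ (1 , c₀ ∷ []) e) (ℕ.*-identityʳ e)) ([1+p]^1∸1≡p p)

    large-* : ∀ {f n} D {X} s m → Coprime X q → Coprime m q → p * p < X * m → n ≡ q ^ s * m → Shape f (q ^ D * X * n)
    large-* D {X} s m X⊥q m⊥q p*p<Xm n≡ =
      large (D + s) (X * m) (coprime-* X⊥q m⊥q) p*p<Xm (trans (cong (q ^ D * X *_) n≡) (^*-*-^* q D X s m))

  shape-prime-power : ∀ P → 1 ≤ deg P → ∀ e → Shape (P ^ᵐ suc e) (q ^ deg (P ^ᵐ e) * (q ^ deg P ∸ 1))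
  shape-prime-power (suc zero , c₀ ∷ []) _ e = one-root (- c₀) e (cong (_^ᵐ suc e) (linear≡x- c₀)) (linear-power-count c₀ e)
  shape-prime-power P@(suc (suc d) , c) _ e =
    large (deg (P ^ᵐ e)) (q ^ deg P ∸ 1) (coprime-^∸1 (suc d)) (p*p<[1+p]^d∸1 (deg P) 1≤p (s≤s (s≤s z≤n))) refl

  shape-* : ∀ P → 1 ≤ deg P → ∀ e g {n} → ¬ ⟦ P ⟧ ∣ₚ ⟦ g ⟧ → Shape g n →
            Shape (P ^ᵐ suc e *ᵐ g) (q ^ deg (P ^ᵐ e) * (q ^ deg P ∸ 1) * n)
  shape-* (suc zero , c₀ ∷ []) _ e g P∤g (one-root b j refl n≡) =
    two-roots (- c₀) b e j a≢b (cong (λ P → P ^ᵐ suc e *ᵐ (x- b) ^ᵐ suc j) (linear≡x- c₀))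
      (trans (cong₂ _*_ (linear-power-count c₀ e) n≡) (^*-*-^* q e p j p))
    where
      a≢b : - c₀ ≢ b
      a≢b refl = P∤g (subst (λ P → ⟦ P ⟧ ∣ₚ ⟦ (x- b) ^ᵐ suc j ⟧) (sym (linear≡x- c₀)) (∣ₚ-^ᵐ-suc (x- b) j))
  shape-* P@(suc (suc d) , c) _ e g P∤g (one-root b j _ n≡) =
    large-* (deg (P ^ᵐ e)) j p (coprime-^∸1 (suc d)) p⊥q
      (ℕ.<-≤-trans (p*p<[1+p]^d∸1 (deg P) 1≤p (s≤s (s≤s z≤n))) (ℕ.m≤m*n (q ^ deg P ∸ 1) p)) n≡
  shape-* P@(suc d , c) _ e g P∤g (two-roots a b i j _ _ n≡) =
    large-* (deg (P ^ᵐ e)) (i + j) (p * p) (coprime-^∸1 d) (coprime-* p⊥q p⊥q)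
      (subst (p * p <_) (ℕ.*-comm (p * p) X) (ℕ.m<m*n (p * p) X (ℕ.<-≤-trans 2≤p (p≤[1+p]^d∸1 p (deg P) (s≤s z≤n))))) n≡
    where
      X = q ^ deg P ∸ 1
      instance _ = ℕ.m*n≢0 p p
  shape-* P@(suc d , c) _ e g P∤g (large s m m⊥q p*p<m n≡) =
    large-* (deg (P ^ᵐ e)) s m (coprime-^∸1 d) m⊥q (ℕ.m<n⇒m<o*n (q ^ deg P ∸ 1) p*p<m) n≡
    where instance _ = ℕ.>-nonZero (ℕ.≤-trans 1≤p (p≤[1+p]^d∸1 p (deg P) (s≤s z≤n)))

  classify : ∀ f → 1 ≤ deg f → Σ ℕ λ n → UnitCount f n × Shape f n
  classify f = go f (<-wellFounded (deg f))
    where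
      go : ∀ f → Acc _<_ (deg f) → 1 ≤ deg f → Σ ℕ λ n → UnitCount f n × Shape f n
      go f (acc smaller) 1≤f with prime-divisor f 1≤f
      ... | P , P-prime@(1≤P , _) , P∣f with prime-power-split P f P-prime P∣f
      ...   | e , (zero , []) , refl , _ = N , subst (λ f → UnitCount f N × Shape f N) (sym (*ᵐ-identityʳ (P ^ᵐ suc e)))
                                                    (unitCount-prime-power′ P P-prime e , shape-prime-power P 1≤P e)
        where N = q ^ deg (P ^ᵐ e) * (q ^ deg P ∸ 1)
      ...   | e , g@(suc _ , _) , refl , P∤g with go g (smaller (ℕ.m<n+m (deg g) (ℕ.<-≤-trans 1≤P (ℕ.m≤m+n (deg P) _)))) (s≤s z≤n)
      ...     | n , count-g , shape-g =
        _ , unitCount-* (P ^ᵐ suc e) g (invertible-mod-^ᵐ P (suc e) (proj₂ P-prime ⟦ g ⟧ P∤g))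
                        (unitCount-prime-power′ P P-prime e) count-g ,
        shape-* P 1≤P e g P∤g shape-g

  shape-q^l*p² : ∀ {f} l → Shape f (q ^ l * (p * p)) →
                 Σ Carrier λ a → Σ Carrier λ b → Σ ℕ λ i → Σ ℕ λ j → a ≢ b × i + j ≡ l × f ≡ twoRoots a b i j
  shape-q^l*p² l (one-root a i _ n≡) =
    contradiction (proj₂ (^*-coprime-injective l i 2≤q (coprime-* p⊥q p⊥q) p⊥q n≡)) (ℕ.<⇒≢ p<p*p ∘ sym)
    where p<p*p = subst (_< p * p) (ℕ.*-identityʳ p) (ℕ.*-monoʳ-< p 2≤p)
  shape-q^l*p² l (two-roots a b i j a≢b f≡ n≡) =
    a , b , i , j , a≢b , sym (proj₁ (^*-coprime-injective l (i + j) 2≤q (coprime-* p⊥q p⊥q) (coprime-* p⊥q p⊥q) n≡)) , f≡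
  shape-q^l*p² l (large s m m⊥q p*p<m n≡) =
    contradiction (proj₂ (^*-coprime-injective l s 2≤q (coprime-* p⊥q p⊥q) m⊥q n≡)) (ℕ.<⇒≢ p*p<m)

module PhiFibres (F : FiniteField) where
  open import Data.Nat using (_+_; _*_)
  open FiniteField F using (Carrier; size; enum; 0#; 1#; 0≢1)
  open Poly F
  open PolynomialRing F using (_≋_; ≈ₚ⇔≋)
  open Division F
  open Divisibility F
  open Monic F
  open Units F
  open Totient F
  open LinearFactors F
  module E = Inverse enum

  toMonic : MonicNC → Monic
  toMonic (d , v) = suc d , v

  toMonic-injective : ∀ {f g} → toMonic f ≡ toMonic g → f ≡ g
  toMonic-injective {_ , _} {_ , _} refl = refl

  isUnitMod⇔invertible : ∀ f g → IsUnitMod f g ⇔ InvertibleMod f g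
  isUnitMod⇔invertible f g = mk⇔ (λ (h , k , eq) → invertible h k (to (≈ₚ⇔≋ _ _) eq))
                                 (λ (invertible h k eq) → h , k , from (≈ₚ⇔≋ _ _) eq)
    where open Equivalence

  phiIs⇔unitCount : ∀ f n → PhiIs f n ⇔ UnitCount (toMonic f) n
  phiIs⇔unitCount f n = mk⇔ (HasCard-⇔ (λ r → isUnitMod⇔invertible _ (toList r)))
                            (HasCard-⇔ (λ r → ⇔-sym (isUnitMod⇔invertible _ (toList r))))
    where open import Function.Properties.Equivalence using () renaming (sym to ⇔-sym)

  to-injective : ∀ {a b} → E.to a ≡ E.to b → a ≡ b
  to-injective {a} {b} eq = trans (sym (E.strictlyInverseʳ a)) (trans (cong E.from eq) (E.strictlyInverseʳ b))

  from-injective : ∀ {x y} → E.from x ≡ E.from y → x ≡ y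
  from-injective {x} {y} eq = trans (sym (E.strictlyInverseˡ x)) (trans (cong E.to eq) (E.strictlyInverseˡ y))

  sorted-pair-unique : ∀ {n} {x y x′ y′ : Fin n} → x Fin.< y → x′ Fin.< y′ →
                       x ≡ x′ ⊎ x ≡ y′ → y ≡ x′ ⊎ y ≡ y′ → x′ ≡ x ⊎ x′ ≡ y → x ≡ x′ × y ≡ y′
  sorted-pair-unique x<y _ (inj₁ refl) (inj₁ refl) _ = ⊥-elim (Fin.<-irrefl refl x<y)
  sorted-pair-unique _ _ (inj₁ refl) (inj₂ refl) _ = refl , refl
  sorted-pair-unique _ x′<y′ (inj₂ refl) _ (inj₁ refl) = ⊥-elim (Fin.<-irrefl refl x′<y′)
  sorted-pair-unique x<y x′<y′ (inj₂ refl) _ (inj₂ refl) = ⊥-elim (Fin.<-asym x<y x′<y′)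

  sorted⇒distinct : ∀ {x y} → x Fin.< y → E.from x ≢ E.from y
  sorted⇒distinct {x} x<y a≡b = Fin.<-irrefl refl (subst (x Fin.<_) (sym (from-injective a≡b)) x<y)

  size≢2⇒size≡1+p : size ≢ 2 → Σ ℕ λ p → size ≡ suc p × 2 ≤ p
  size≢2⇒size≡1+p size≢2 = go (E.to 0#) (E.to 1#) (0≢1 ∘ to-injective) size≢2
    where
      go : ∀ {m} (a b : Fin m) → a ≢ b → m ≢ 2 → Σ ℕ λ p → m ≡ suc p × 2 ≤ p
      go {1} Fin.zero Fin.zero a≢b _ = ⊥-elim (a≢b refl)
      go {2} _ _ _ m≢2 = ⊥-elim (m≢2 refl)
      go {suc (suc (suc k))} _ _ _ _ = suc (suc k) , refl , s≤s (s≤s z≤n)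

  module TwoRootFibre (p : ℕ) (size≡1+p : size ≡ suc p) (2≤p : 2 ≤ p) (l : ℕ) where
    open Classification F p size≡1+p 2≤p

    Index : Set
    Index = (Fin size × Fin size) × Fin (suc l)

    -- The ⊤ is the (trivial) condition on the exponent, as produced by HasCard-× with HasCard-Fin.
    Sorted : Index → Set
    Sorted ((x , y) , _) = x Fin.< y × ⊤

    polynomial : Index → MonicNC
    polynomial ((x , y) , i) = _ , proj₂ (twoRoots (E.from x) (E.from y) (toℕ i) (l ∸ toℕ i))

    polynomial-injective : ∀ {ix iy} → Sorted ix → Sorted iy → polynomial ix ≡ polynomial iy → ix ≡ iy
    polynomial-injective {(x , y) , i} {(x′ , y′) , i′} (x<y , _) (x′<y′ , _) eq
      with sorted-pair-unique x<y x′<y′ (root-of (x-∣twoRoots a b (toℕ i) (l ∸ toℕ i))) (root-of x-b∣f)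
                                         (root-of′ (x-∣twoRoots a′ b′ (toℕ i′) (l ∸ toℕ i′)))
      where
        a = E.from x
        b = E.from y
        a′ = E.from x′
        b′ = E.from y′
        f = twoRoots a b (toℕ i) (l ∸ toℕ i)
        f′ = twoRoots a′ b′ (toℕ i′) (l ∸ toℕ i′)
        f≡f′ : f ≡ f′
        f≡f′ = cong toMonic eq
        root-of : ∀ {z} → ⟦ x- E.from z ⟧ ∣ₚ ⟦ f ⟧ → z ≡ x′ ⊎ z ≡ y′
        root-of {z} = Sum.map from-injective from-injective ∘ roots-of-twoRoots a′ b′ (toℕ i′) (l ∸ toℕ i′)
                      ∘ subst (λ f → ⟦ x- E.from z ⟧ ∣ₚ ⟦ f ⟧) f≡f′
        root-of′ : ∀ {z} → ⟦ x- E.from z ⟧ ∣ₚ ⟦ f′ ⟧ → z ≡ x ⊎ z ≡ y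
        root-of′ {z} = Sum.map from-injective from-injective ∘ roots-of-twoRoots a b (toℕ i) (l ∸ toℕ i)
                       ∘ subst (λ f → ⟦ x- E.from z ⟧ ∣ₚ ⟦ f ⟧) (sym f≡f′)
        x-b∣f : ⟦ x- b ⟧ ∣ₚ ⟦ f ⟧
        x-b∣f = subst (λ f → ⟦ x- b ⟧ ∣ₚ ⟦ f ⟧) (sym (twoRoots-comm a b (toℕ i) (l ∸ toℕ i)))
                      (x-∣twoRoots b a (l ∸ toℕ i) (toℕ i))
    ... | refl , refl = cong ((x , y) ,_) (Fin.toℕ-injective
      (twoRoots-exponent-injective (sorted⇒distinct x<y) {toℕ i} {l ∸ toℕ i} {toℕ i′} {l ∸ toℕ i′} (cong toMonic eq)))

    n : ℕ
    n = q ^ l * (p * p)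

    0<n : 0 < n
    0<n = ℕ.*-mono-≤ (ℕ.m^n>0 q l) (ℕ.*-mono-≤ (ℕ.≤-trans (s≤s z≤n) 2≤p) (ℕ.≤-trans (s≤s z≤n) 2≤p))

    polynomial-twoRoots : ∀ {a b i j} → i + j ≡ l → (i<1+l : i < suc l) →
                          toMonic (polynomial ((E.to a , E.to b) , fromℕ< i<1+l)) ≡ twoRoots a b i j
    polynomial-twoRoots {a} {b} {i} {j} i+j≡l i<1+l = begin
      twoRoots (E.from (E.to a)) (E.from (E.to b)) (toℕ (fromℕ< i<1+l)) (l ∸ toℕ (fromℕ< i<1+l))
        ≡⟨ cong₂ (λ a b → twoRoots a b (toℕ (fromℕ< i<1+l)) (l ∸ toℕ (fromℕ< i<1+l)))
                 (E.strictlyInverseʳ a) (E.strictlyInverseʳ b) ⟩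
      twoRoots a b (toℕ (fromℕ< i<1+l)) (l ∸ toℕ (fromℕ< i<1+l))
        ≡⟨ cong (λ k → twoRoots a b k (l ∸ k)) (Fin.toℕ-fromℕ< i<1+l) ⟩
      twoRoots a b i (l ∸ i)
        ≡⟨ cong (twoRoots a b i) (trans (cong (_∸ i) (sym i+j≡l)) (ℕ.m+n∸m≡n i j)) ⟩
      twoRoots a b i j ∎
      where open ≡-Reasoning

    Φ⁻¹⇔image : ∀ f → PhiIs f n ⇔ Σ Index λ ix → Sorted ix × polynomial ix ≡ f
    Φ⁻¹⇔image f = mk⇔ to from
      where
        from : (Σ Index λ ix → Sorted ix × polynomial ix ≡ f) → PhiIs f n
        from (((x , y) , i) , (x<y , _) , refl) = Equivalence.from (phiIs⇔unitCount _ n)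
          (subst (UnitCount _) (cong (λ k → q ^ k * (p * p)) (ℕ.m+[n∸m]≡n (ℕ.≤-pred (Fin.toℕ<n i))))
            (unitCount-twoRoots (sorted⇒distinct x<y) (toℕ i) (l ∸ toℕ i)))
        to : PhiIs f n → Σ Index λ ix → Sorted ix × polynomial ix ≡ f
        to Φf≡n with classify (toMonic f) (s≤s z≤n)
        ... | n′ , count-f , shape-f
          with shape-q^l*p² l (subst (Shape (toMonic f)) (HasCard-unique count-f (Equivalence.to (phiIs⇔unitCount f n) Φf≡n)) shape-f)
        ... | a , b , i , j , a≢b , i+j≡l , f≡ with Fin.<-cmp (E.to a) (E.to b)
        ...   | tri< a<b _ _ = ((E.to a , E.to b) , fromℕ< i<1+l) , (a<b , tt) ,
                               toMonic-injective (trans (polynomial-twoRoots i+j≡l i<1+l) (sym f≡))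
          where i<1+l = s≤s (subst (i ≤_) i+j≡l (ℕ.m≤m+n i j))
        ...   | tri≈ _ a≡b _ = ⊥-elim (a≢b (to-injective a≡b))
        ...   | tri> _ _ b<a = ((E.to b , E.to a) , fromℕ< j<1+l) , (b<a , tt) ,
                               toMonic-injective (trans (polynomial-twoRoots (trans (ℕ.+-comm j i) i+j≡l) j<1+l)
                                                        (trans (sym (twoRoots-comm a b i j)) (sym f≡)))
          where j<1+l = s≤s (subst (j ≤_) i+j≡l (ℕ.m≤n+m j i))

    Φ⁻¹-count : HasCard (λ f → PhiIs f n) ((size C 2) * suc l)
    Φ⁻¹-count = HasCard-image polynomial polynomial-injective Φ⁻¹⇔image (HasCard-× (HasCard-<-pairs size) HasCard-Fin)

open import Data.Nat using (_*_)

mainTheorem8 : (F : FiniteField) → FiniteField.size F ≢ 2 → (l : ℕ) →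
    ∃ λ n → 0 < n × HasCard (λ f → Poly.PhiIs F f n) ((FiniteField.size F C 2) * suc l)
mainTheorem8 F size≢2 l with PhiFibres.size≢2⇒size≡1+p F size≢2
... | p , size≡1+p , 2≤p = n , 0<n , Φ⁻¹-count
  where open PhiFibres.TwoRootFibre F p size≡1+p 2≤p l
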